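{- For a connected circulant graph $G$ with $n\ge 3$ vertices, $$\frac{n}{n-1}\le C(G)\le \frac{n(n-1)(n-2)}{4}.$$ The first inequality is an equality if and only if $G=C_n$. The second inequality is an equality if and only if $G=K_n$.
   Context: All graphs are finite and simple. A circulant graph on $n$ vertices has vertex set $\mathbb{Z}_n$ and a list $l$ of positive integers. Vertex $i$ is adjacent to $i+j$ and $i-j$ (mod $n$) for each $j\in l$. For a connected graph $G$, regard each edge as a unit resistor. $\Omega_G(i,j)$ is the effective resistance between $i$ and $j$. The global cyclicity index is $$C(G)=\sum_{ij\in E(G)}\Big[\frac{1}{\Omega_G(i,j)}-1\Big].$$ $C_n$ is the cycle on $n$ vertices and $K_n$ is the complete graph on $n$ vertices. -}

module Defs where

open import Data.Nat as ℕ using (ℕ; zero; suc; _%_)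
open import Data.Fin using (Fin; toℕ)
open import Data.Fin.Permutation using (Permutation′; _⟨$⟩ʳ_)
open import Data.Bool using (Bool; true; false; _∧_; _∨_; not; if_then_else_)
open import Data.List using (List; []; _∷_)
open import Data.Integer using (+_)
open import Data.Rational using (ℚ; 0ℚ; 1ℚ; _+_; _-_; -_; 1/_; ≢-nonZero)
open import Data.Rational.Properties using (_≟_)
open import Relation.Nullary using (yes; no)
open import Relation.Nullary.Decidable using (⌊_⌋)
open import Relation.Binary.PropositionalEquality using (_≡_)
open import Relation.Binary.Construct.Closure.ReflexiveTransitive using (Star)
open import Data.Product using (∃; _×_)

-- Circulant graph on ℤ_n (vertices Fin n) with jump list l.
-- i ~ j  iff  for some k ∈ l (k ≥ 1) with k ≢ 0 (mod n):
--   j ≡ i + k (mod n)  or  i ≡ j + k (mod n).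
-- (Jumps k ≡ 0 mod n would give loops; graphs are simple, so they add no edge.)

_==ℕ_ : ℕ → ℕ → Bool
m ==ℕ n = ⌊ m ℕ.≟ n ⌋

circAdj : (n : ℕ) .{{_ : ℕ.NonZero n}} → List ℕ → Fin n → Fin n → Bool
circAdj n [] i j = false
circAdj n (k ∷ l) i j =
  (not ((k % n) ==ℕ 0) ∧
    ((((toℕ i ℕ.+ k) % n) ==ℕ toℕ j) ∨ (((toℕ j ℕ.+ k) % n) ==ℕ toℕ i)))
  ∨ circAdj n l i j

Graph : ℕ → Set
Graph n = Fin n → Fin n → Bool

Circulant : (n : ℕ) .{{_ : ℕ.NonZero n}} → List ℕ → Graph n
Circulant n l = circAdj n l

Edge : ∀ {n} → Graph n → Fin n → Fin n → Set
Edge G i j = G i j ≡ true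

Connected : ∀ {n} → Graph n → Set
Connected {n} G = (i j : Fin n) → Star (Edge G) i j

sumFin : (n : ℕ) → (Fin n → ℚ) → ℚ
sumFin zero f = 0ℚ
sumFin (suc n) f = f Fin.zero + sumFin n (λ i → f (Fin.suc i))
  where import Data.Fin as Fin

-- Effective resistance (unit resistors on edges).
-- x is a potential; Kirchhoff's current law: net current leaving v is
-- Σ_{u ~ v} (x v - x u), which must equal +1 at i, -1 at j, 0 elsewhere.
-- Ω(i,j) = x i - x j.  For connected G and i ≠ j this is uniquely determined.

_==F_ : ∀ {n} → Fin n → Fin n → Bool
a ==F b = toℕ a ==ℕ toℕ b

netCurrent : ∀ {n} → Graph n → (Fin n → ℚ) → Fin n → ℚ
netCurrent {n} G x v = sumFin n (λ u → if G v u then x v - x u else 0ℚ)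

source : ∀ {n} → Fin n → Fin n → Fin n → ℚ
source i j v = if v ==F i then 1ℚ else (if v ==F j then - 1ℚ else 0ℚ)

IsEffRes : ∀ {n} → Graph n → Fin n → Fin n → ℚ → Set
IsEffRes {n} G i j r =
  ∃ λ (x : Fin n → ℚ) → ((v : Fin n) → netCurrent G x v ≡ source i j v) × (r ≡ x i - x j)

-- Global cyclicity index, given the effective-resistance function Ω.
-- inv is 1/p (only applied to Ω on edges, which is positive).

inv : ℚ → ℚ
inv p with p ≟ 0ℚ
... | yes _ = 0ℚ
... | no p≢0 = 1/_ p {{≢-nonZero p≢0}}

cyclicity : ∀ {n} → Graph n → (Fin n → Fin n → ℚ) → ℚ
cyclicity {n} G Ω =
  sumFin n (λ i → sumFin n (λ j →
    if ⌊ toℕ i ℕ.<? toℕ j ⌋ ∧ G i j then inv (Ω i j) - 1ℚ else 0ℚ))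

cycleGraph : (n : ℕ) .{{_ : ℕ.NonZero n}} → Graph n
cycleGraph n i j =
  not (i ==F j) ∧ ((((toℕ i ℕ.+ 1) % n) ==ℕ toℕ j) ∨ (((toℕ j ℕ.+ 1) % n) ==ℕ toℕ i))

completeGraph : (n : ℕ) → Graph n
completeGraph n i j = not (i ==F j)

Isomorphic : ∀ {n} → Graph n → Graph n → Set
Isomorphic {n} G H =
  ∃ λ (σ : Permutation′ n) → (i j : Fin n) → G i j ≡ H (σ ⟨$⟩ʳ i) (σ ⟨$⟩ʳ j)

module Submission where

-- Let ij be an edge of a connected circulant graph on n ≥ 3 vertices. Then 2/n ≤ Ω(i,j) ≤ (n-1)/n.
-- The lower bound is Kirchhoff's law at i and j, since by the maximum principle every potential
-- lies between those of i and j. The upper bound is Thomson's principle for an explicit unit flow: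
-- current 1 - 1/n along the edge and 1/n back along every other edge of the same jump k or, when
-- 2k ≡ 0 (mod n) and hence n ≥ 4, current 3/4 along the edge and 1/4 around a 4-cycle through a
-- second jump t with 2t ≢ 0, which exists by connectivity. So every edge contributes 1/Ω - 1
-- between 1/(n-1) and (n-2)/2, and as every vertex has degree at least 2 there are between n and
-- n(n-1)/2 edges. Equality on the left forces exactly n edges, hence every jump is ±k and G is a
-- cycle, where Dirichlet's principle for a potential that is linear along the cycle gives
-- Ω = (n-1)/n. Equality on the right forces every pair to be adjacent, and on K_n Kirchhoff's law
-- gives Ω = 2/n.

module CirculantNetworks where

  open import Algebra.Bundles using (AbelianGroup)
  import Algebra.Properties.AbelianGroup as AbelianGroupProperties
  import Algebra.Properties.CommutativeMonoid.Sum as CommutativeMonoidSum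
  import Algebra.Properties.CommutativeSemigroup as CommutativeSemigroupProperties
  import Algebra.Properties.Group as GroupProperties
  open import Data.Bool using (Bool; true; false; if_then_else_; not; _∧_; _∨_)
  open import Data.Bool.Properties using (∨-comm; ∨-zeroʳ)
  open import Data.Empty using (⊥-elim)
  open import Data.Fin using (Fin; zero; suc; toℕ)
  import Data.Fin as Fin
  open import Data.Fin.Permutation using (Permutation′; _⟨$⟩ʳ_; permutation)
  import Data.Fin.Permutation as Permutation
  import Data.Fin.Properties as Finₚ
  import Data.Integer as ℤ
  import Data.Integer.Properties as ℤₚ
  open import Data.List using (List; []; _∷_)
  open import Data.List.Membership.Propositional using (_∈_; find; lose)
  open import Data.List.Relation.Unary.Any using (any?; here; there)
  open import Data.Nat as ℕ using (ℕ; zero; suc; _∸_; _%_)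
  import Data.Nat.Properties as ℕₚ
  open import Data.Nat.DivMod using (_mod_; %-distribˡ-+; %-distribˡ-*; m<n⇒m%n≡m; n%n≡0; m%n%n≡m%n; [m+n]%n≡m%n)
  open import Data.Product using (Σ; ∃; _×_; _,_; proj₁; proj₂)
  open import Data.Rational as ℚ using (ℚ; 0ℚ; 1ℚ; _+_; _-_; -_; _*_; _≤_; _<_; 1/_)
  open import Data.Rational.Properties
  open import Data.Rational.Solver using (module +-*-Solver)
  import Data.Rational.Unnormalised as ℚᵘ
  import Data.Rational.Unnormalised.Properties as ℚᵘₚ
  open import Data.Sum using (_⊎_; inj₁; inj₂; [_,_]′)
  open import Function using (_∘_; Injective)
  open import Function.Bundles using (_⇔_; mk⇔)
  open import Relation.Binary.Construct.Closure.ReflexiveTransitive using (Star; ε; _◅_)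
  open import Relation.Binary.Definitions using (tri<; tri≈; tri>)
  open import Relation.Binary.PropositionalEquality
  open import Relation.Nullary using (¬_; yes; no; ¬?)
  open import Relation.Nullary.Decidable using (⌊_⌋; isYes≗does; dec-true; dec-false; decidable-stable; _×-dec_)

  open import Defs

  open +-*-Solver using (solve; _:+_; _:-_; _:*_; :-_; _:=_; con)
  open GroupProperties +-0-group using ()
    renaming (∙-cancelˡ to +-cancelˡ; x∙y⁻¹≈ε⇒x≈y to p-q≡0⇒p≡q; ⁻¹-involutive to neg-involutive)

  fromℕ : ℕ → ℚ
  fromℕ zero = 0ℚ
  fromℕ (suc k) = 1ℚ + fromℕ k

  fromℕ-+ : ∀ a b → fromℕ (a ℕ.+ b) ≡ fromℕ a + fromℕ b
  fromℕ-+ zero b = sym (+-identityˡ (fromℕ b))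
  fromℕ-+ (suc a) b = trans (cong (1ℚ +_) (fromℕ-+ a b)) (sym (+-assoc 1ℚ (fromℕ a) (fromℕ b)))

  fromℕ-* : ∀ a b → fromℕ (a ℕ.* b) ≡ fromℕ a * fromℕ b
  fromℕ-* zero b = sym (*-zeroˡ (fromℕ b))
  fromℕ-* (suc a) b = begin
    fromℕ (b ℕ.+ a ℕ.* b)         ≡⟨ fromℕ-+ b (a ℕ.* b) ⟩
    fromℕ b + fromℕ (a ℕ.* b)     ≡⟨ cong (fromℕ b +_) (fromℕ-* a b) ⟩
    fromℕ b + fromℕ a * fromℕ b   ≡⟨ solve 2 (λ a b → b :+ a :* b := (con 1ℚ :+ a) :* b) refl (fromℕ a) (fromℕ b) ⟩
    (1ℚ + fromℕ a) * fromℕ b      ∎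
    where open ≡-Reasoning

  0≤fromℕ : ∀ k → 0ℚ ≤ fromℕ k
  0≤fromℕ zero = ≤-refl
  0≤fromℕ (suc k) = +-mono-≤ (nonNegative⁻¹ 1ℚ) (0≤fromℕ k)

  0<fromℕ-suc : ∀ k → 0ℚ < fromℕ (suc k)
  0<fromℕ-suc k = +-mono-<-≤ (positive⁻¹ 1ℚ) (0≤fromℕ k)

  fromℕ-suc-nonZero : ∀ k → ℚ.NonZero (fromℕ (suc k))
  fromℕ-suc-nonZero k = pos⇒nonZero (fromℕ (suc k)) {{ℚ.positive (0<fromℕ-suc k)}}

  1/suc : ℕ → ℚ
  1/suc k = (1/ fromℕ (suc k)) {{fromℕ-suc-nonZero k}}

  fromℕ-suc*1/suc : ∀ k → fromℕ (suc k) * 1/suc k ≡ 1ℚ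
  fromℕ-suc*1/suc k = *-inverseʳ (fromℕ (suc k)) {{fromℕ-suc-nonZero k}}

  0<1/suc : ∀ k → 0ℚ < 1/suc k
  0<1/suc k = positive⁻¹ _ {{1/pos⇒pos (fromℕ (suc k)) {{ℚ.positive (0<fromℕ-suc k)}}}}

  fromℕ-toℚᵘ : ∀ k → ℚ.toℚᵘ (fromℕ k) ℚᵘ.≃ ℚᵘ.mkℚᵘ (ℤ.+ k) 0
  fromℕ-toℚᵘ zero = ℚᵘ.*≡* refl
  fromℕ-toℚᵘ (suc k) =
    ℚᵘₚ.≃-trans (toℚᵘ-homo-+ 1ℚ (fromℕ k))
      (ℚᵘₚ.≃-trans (ℚᵘₚ.+-cong (ℚᵘₚ.≃-refl {ℚᵘ.1ℚᵘ}) (fromℕ-toℚᵘ k)) (ℚᵘ.*≡* (trans (ℤₚ.*-identityʳ _)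
        (trans (cong (ℤ._+_ (ℤ.+ 1)) (ℤₚ.*-identityʳ (ℤ.+ k))) (sym (ℤₚ.*-identityʳ _))))))

  fromℕ-suc*/suc : ∀ a b → fromℕ (suc b) * (ℤ.+ a ℚ./ suc b) ≡ fromℕ a
  fromℕ-suc*/suc a b = toℚᵘ-injective (ℚᵘₚ.≃-trans (toℚᵘ-homo-* (fromℕ (suc b)) _)
    (ℚᵘₚ.≃-trans (ℚᵘₚ.*-cong (fromℕ-toℚᵘ (suc b)) (toℚᵘ-fromℚᵘ (ℚᵘ.mkℚᵘ (ℤ.+ a) b)))
    (ℚᵘₚ.≃-trans (ℚᵘ.*≡* (trans (ℤₚ.*-identityʳ _)
        (trans (ℤₚ.*-comm (ℤ.+ suc b) (ℤ.+ a)) (cong (ℤ._*_ (ℤ.+ a)) (sym (ℤₚ.*-identityˡ _))))))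
      (ℚᵘₚ.≃-sym (fromℕ-toℚᵘ a)))))

  /suc≡fromℕ*1/suc : ∀ a b → ℤ.+ a ℚ./ suc b ≡ fromℕ a * 1/suc b
  /suc≡fromℕ*1/suc a b = begin
    x                                 ≡⟨ sym (*-identityˡ x) ⟩
    1ℚ * x                            ≡⟨ cong (_* x) (sym (trans (*-comm (1/suc b) _) (fromℕ-suc*1/suc b))) ⟩
    (1/suc b * fromℕ (suc b)) * x     ≡⟨ *-assoc (1/suc b) _ x ⟩
    1/suc b * (fromℕ (suc b) * x)     ≡⟨ cong (1/suc b *_) (fromℕ-suc*/suc a b) ⟩
    1/suc b * fromℕ a                 ≡⟨ *-comm (1/suc b) (fromℕ a) ⟩
    fromℕ a * 1/suc b                 ∎
    where
    open ≡-Reasoning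
    x : ℚ
    x = ℤ.+ a ℚ./ suc b

  *-monoˡ-≤-0≤ : ∀ {r p q} → 0ℚ ≤ r → p ≤ q → r * p ≤ r * q
  *-monoˡ-≤-0≤ {r} 0≤r = *-monoˡ-≤-nonNeg r {{ℚ.nonNegative 0≤r}}

  *-monoʳ-≤-0≤ : ∀ {r p q} → 0ℚ ≤ r → p ≤ q → p * r ≤ q * r
  *-monoʳ-≤-0≤ {r} 0≤r = *-monoʳ-≤-nonNeg r {{ℚ.nonNegative 0≤r}}

  +-cancelʳ-≤ : ∀ {a b} c → a + c ≤ b + c → a ≤ b
  +-cancelʳ-≤ {a} {b} c h = subst₂ _≤_ (cancel a) (cancel b) (+-monoˡ-≤ (- c) h)
    where
    cancel : ∀ p → p + c - c ≡ p
    cancel p = solve 2 (λ p c → p :+ c :- c := p) refl p c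

  p≤q⇒0≤q-p : ∀ {p q} → p ≤ q → 0ℚ ≤ q - p
  p≤q⇒0≤q-p {p} {q} p≤q = subst (_≤ q - p) (+-inverseʳ p) (+-monoˡ-≤ (- p) p≤q)

  x+x≤y+y⇒x≤y : ∀ {x y} → x + x ≤ y + y → x ≤ y
  x+x≤y+y⇒x≤y {x} {y} h with x ℚ.≤? y
  ... | yes x≤y = x≤y
  ... | no x≰y = ⊥-elim (<-irrefl refl (≤-<-trans h (+-mono-< y<x y<x)))
    where
    y<x : y < x
    y<x = ≰⇒> x≰y

  sq : ℚ → ℚ
  sq p = p * p

  sq-neg : ∀ p → sq (- p) ≡ sq p
  sq-neg p = solve 1 (λ p → (:- p) :* (:- p) := p :* p) refl p

  0≤x*x : ∀ x → 0ℚ ≤ x * x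
  0≤x*x x with ≤-total 0ℚ x
  ... | inj₁ 0≤x = ≤-trans (≤-reflexive (sym (*-zeroʳ x))) (*-monoˡ-≤-0≤ 0≤x 0≤x)
  ... | inj₂ x≤0 = subst (0ℚ ≤_) (solve 1 (λ x → (:- x) :* (:- x) := x :* x) refl x)
                      (≤-trans (≤-reflexive (sym (*-zeroʳ (- x)))) (*-monoˡ-≤-0≤ (neg-antimono-≤ x≤0) (neg-antimono-≤ x≤0)))

  2xy≤x²+y² : ∀ x y → x * y + x * y ≤ x * x + y * y
  2xy≤x²+y² x y = subst₂ _≤_ (+-identityˡ (x * y + x * y)) (solve 2 (λ x y → (x :- y) :* (x :- y) :+ (x :* y :+ x :* y) := x :* x :+ y :* y) refl x y)
                    (+-monoˡ-≤ (x * y + x * y) (0≤x*x (x - y)))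

  *-inv : ∀ {p} → 0ℚ < p → p * inv p ≡ 1ℚ
  *-inv {p} 0<p with p ≟ 0ℚ
  ... | yes refl = ⊥-elim (<-irrefl refl 0<p)
  ... | no p≢0 = *-inverseʳ p {{ℚ.≢-nonZero p≢0}}

  0≤inv : ∀ {p} → 0ℚ < p → 0ℚ ≤ inv p
  0≤inv {p} 0<p with p ≟ 0ℚ
  ... | yes refl = ⊥-elim (<-irrefl refl 0<p)
  ... | no p≢0 = <⇒≤ (positive⁻¹ _ {{1/pos⇒pos p {{ℚ.positive 0<p}}}})

  ≤-inv : ∀ {p c} → 0ℚ < p → c * p ≤ 1ℚ → c ≤ inv p
  ≤-inv {p} {c} 0<p h = begin
    c                  ≡⟨ sym (*-identityʳ c) ⟩
    c * 1ℚ             ≡⟨ cong (c *_) (sym (*-inv 0<p)) ⟩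
    c * (p * inv p)    ≡⟨ sym (*-assoc c p (inv p)) ⟩
    (c * p) * inv p    ≤⟨ *-monoʳ-≤-0≤ (0≤inv 0<p) h ⟩
    1ℚ * inv p         ≡⟨ *-identityˡ (inv p) ⟩
    inv p              ∎
    where open ≤-Reasoning

  inv-≤ : ∀ {p c} → 0ℚ < p → 1ℚ ≤ c * p → inv p ≤ c
  inv-≤ {p} {c} 0<p h = begin
    inv p              ≡⟨ sym (*-identityˡ (inv p)) ⟩
    1ℚ * inv p         ≤⟨ *-monoʳ-≤-0≤ (0≤inv 0<p) h ⟩
    (c * p) * inv p    ≡⟨ *-assoc c p (inv p) ⟩
    c * (p * inv p)    ≡⟨ cong (c *_) (*-inv 0<p) ⟩
    c * 1ℚ             ≡⟨ *-identityʳ c ⟩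
    c                  ∎
    where open ≤-Reasoning

  inv-unique : ∀ {p c} → 0ℚ < p → c * p ≡ 1ℚ → inv p ≡ c
  inv-unique 0<p h = ≤-antisym (inv-≤ 0<p (≤-reflexive (sym h))) (≤-inv 0<p (≤-reflexive h))

  argmax : ∀ {n} (y : Fin n → ℚ) → Fin n → Σ (Fin n) (λ M → ∀ v → y v ≤ y M)
  argmax {suc zero} y _ = zero , λ { zero → ≤-refl }
  argmax {suc (suc n)} y _ with argmax (λ v → y (suc v)) zero
  ... | M , y≤yM with ≤-total (y zero) (y (suc M))
  ... | inj₁ y0≤ = suc M , λ { zero → y0≤ ; (suc v) → y≤yM v }
  ... | inj₂ ≤y0 = zero , λ { zero → ≤-refl ; (suc v) → ≤-trans (y≤yM v) ≤y0 }

  neg-cancel-≤ : ∀ {p q} → - p ≤ - q → q ≤ p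
  neg-cancel-≤ {p} {q} h = subst₂ _≤_ (neg-involutive q) (neg-involutive p) (neg-antimono-≤ h)

  sum-cong : ∀ {n} {f g : Fin n → ℚ} → (∀ i → f i ≡ g i) → sumFin n f ≡ sumFin n g
  sum-cong {zero} _ = refl
  sum-cong {suc n} f≗g = cong₂ _+_ (f≗g zero) (sum-cong (λ i → f≗g (suc i)))

  sum-+ : ∀ {n} (f g : Fin n → ℚ) → sumFin n (λ i → f i + g i) ≡ sumFin n f + sumFin n g
  sum-+ {zero} f g = sym (+-identityˡ 0ℚ)
  sum-+ {suc n} f g = trans (cong (f zero + g zero +_) (sum-+ (λ i → f (suc i)) (λ i → g (suc i))))
    (solve 4 (λ a b c d → (a :+ b) :+ (c :+ d) := (a :+ c) :+ (b :+ d)) refl (f zero) (g zero) _ _)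

  sum-*ˡ : ∀ {n} c (f : Fin n → ℚ) → sumFin n (λ i → c * f i) ≡ c * sumFin n f
  sum-*ˡ {zero} c f = sym (*-zeroʳ c)
  sum-*ˡ {suc n} c f = trans (cong (c * f zero +_) (sum-*ˡ c (λ i → f (suc i)))) (sym (*-distribˡ-+ c (f zero) _))

  sum-neg : ∀ {n} (f : Fin n → ℚ) → sumFin n (λ i → - f i) ≡ - sumFin n f
  sum-neg {zero} f = refl
  sum-neg {suc n} f = trans (cong (- f zero +_) (sum-neg (λ i → f (suc i)))) (sym (neg-distrib-+ (f zero) _))

  sum-zero : ∀ n → sumFin n (λ _ → 0ℚ) ≡ 0ℚ
  sum-zero zero = refl
  sum-zero (suc n) = trans (cong (0ℚ +_) (sum-zero n)) (+-identityˡ 0ℚ)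

  sum-const : ∀ n c → sumFin n (λ _ → c) ≡ fromℕ n * c
  sum-const zero c = sym (*-zeroˡ c)
  sum-const (suc n) c = trans (cong (c +_) (sum-const n c))
    (solve 2 (λ c k → c :+ k :* c := (con 1ℚ :+ k) :* c) refl c (fromℕ n))

  sum-mono-≤ : ∀ {n} {f g : Fin n → ℚ} → (∀ i → f i ≤ g i) → sumFin n f ≤ sumFin n g
  sum-mono-≤ {zero} _ = ≤-refl
  sum-mono-≤ {suc n} f≤g = +-mono-≤ (f≤g zero) (sum-mono-≤ (λ i → f≤g (suc i)))

  sum-comm : ∀ m n (f : Fin m → Fin n → ℚ) →
    sumFin m (λ i → sumFin n (f i)) ≡ sumFin n (λ j → sumFin m (λ i → f i j))
  sum-comm zero n f = sym (sum-zero n)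
  sum-comm (suc m) n f = trans (cong (sumFin n (f zero) +_) (sum-comm m n (λ i → f (suc i))))
    (sym (sum-+ (f zero) (λ j → sumFin m (λ i → f (suc i) j))))

  sum-support₁ : ∀ {n} (f : Fin n → ℚ) a → (∀ u → u ≢ a → f u ≡ 0ℚ) → sumFin n f ≡ f a
  sum-support₁ {suc n} f zero vanish =
    trans (cong (f zero +_) (trans (sum-cong (λ i → vanish (suc i) λ ())) (sum-zero n))) (+-identityʳ (f zero))
  sum-support₁ {suc n} f (suc a) vanish =
    trans (cong (_+ sumFin n (λ i → f (suc i))) (vanish zero λ ()))
      (trans (+-identityˡ _) (sum-support₁ (λ i → f (suc i)) a (λ u u≢a → vanish (suc u) (u≢a ∘ Finₚ.suc-injective))))

  sum-≤-≡⇒≡ : ∀ {n} {f g : Fin n → ℚ} → (∀ i → f i ≤ g i) → sumFin n f ≡ sumFin n g → ∀ i → f i ≡ g i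
  sum-≤-≡⇒≡ {suc n} {f} {g} f≤g eq = go
    where
    rest≤ : sumFin n (λ i → f (suc i)) ≤ sumFin n (λ i → g (suc i))
    rest≤ = sum-mono-≤ (λ i → f≤g (suc i))
    head≡ : f zero ≡ g zero
    head≡ = ≤-antisym (f≤g zero) (+-cancelʳ-≤ (sumFin n (λ i → f (suc i)))
      (≤-trans (+-monoʳ-≤ (g zero) rest≤) (≤-reflexive (sym eq))))
    rest≡ : sumFin n (λ i → f (suc i)) ≡ sumFin n (λ i → g (suc i))
    rest≡ = +-cancelˡ (f zero) _ _ (trans eq (cong (_+ _) (sym head≡)))
    go : ∀ i → f i ≡ g i
    go zero = head≡
    go (suc i) = sum-≤-≡⇒≡ (λ j → f≤g (suc j)) rest≡ i

  sum-permute : ∀ {n} (π : Permutation′ n) (f : Fin n → ℚ) → sumFin n (λ v → f (π ⟨$⟩ʳ v)) ≡ sumFin n f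
  sum-permute {n} π f = trans (as-∑ (λ v → f (π ⟨$⟩ʳ v))) (trans (sym (∑-permute f π)) (sym (as-∑ f)))
    where
    open CommutativeMonoidSum +-0-commutativeMonoid using (sum; ∑-permute)
    as-∑ : ∀ {n} (g : Fin n → ℚ) → sumFin n g ≡ sum g
    as-∑ {zero} g = refl
    as-∑ {suc n} g = cong (g zero +_) (as-∑ (λ i → g (suc i)))

  if-true : ∀ {A : Set} {b : Bool} {x y : A} → b ≡ true → (if b then x else y) ≡ x
  if-true refl = refl

  if-false : ∀ {A : Set} {b : Bool} {x y : A} → b ≡ false → (if b then x else y) ≡ y
  if-false refl = refl

  ==ℕ⇒≡ : ∀ {a b} → (a ==ℕ b) ≡ true → a ≡ b
  ==ℕ⇒≡ {a} {b} h with a ℕ.≟ b | h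
  ... | yes a≡b | _ = a≡b

  ==ℕ-refl : ∀ a → (a ==ℕ a) ≡ true
  ==ℕ-refl a = trans (isYes≗does (a ℕ.≟ a)) (dec-true (a ℕ.≟ a) refl)

  ==ℕ-≢ : ∀ {a b} → a ≢ b → (a ==ℕ b) ≡ false
  ==ℕ-≢ {a} {b} a≢b = trans (isYes≗does (a ℕ.≟ b)) (dec-false (a ℕ.≟ b) a≢b)

  module _ {n : ℕ} where

    ==F⇒≡ : {a b : Fin n} → (a ==F b) ≡ true → a ≡ b
    ==F⇒≡ h = Finₚ.toℕ-injective (==ℕ⇒≡ h)

    ==F-refl : (a : Fin n) → (a ==F a) ≡ true
    ==F-refl a = ==ℕ-refl (toℕ a)

    ==F-≢ : {a b : Fin n} → a ≢ b → (a ==F b) ≡ false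
    ==F-≢ a≢b = ==ℕ-≢ (a≢b ∘ Finₚ.toℕ-injective)

    ==F-false⇒≢ : {a b : Fin n} → (a ==F b) ≡ false → a ≢ b
    ==F-false⇒≢ {a} h refl with trans (sym h) (==F-refl a)
    ... | ()

    erase : (Fin n → ℚ) → Fin n → Fin n → ℚ
    erase f a u = if u ==F a then 0ℚ else f u

    erase-≢ : ∀ f {a u} → u ≢ a → erase f a u ≡ f u
    erase-≢ f u≢a = if-false (==F-≢ u≢a)

    sum-erase : ∀ (f : Fin n → ℚ) a → sumFin n f ≡ f a + sumFin n (erase f a)
    sum-erase f a = begin
      sumFin n f                                  ≡⟨ sum-cong split ⟩
      sumFin n (λ u → δ u + erase f a u)          ≡⟨ sum-+ δ (erase f a) ⟩
      sumFin n δ + sumFin n (erase f a)           ≡⟨ cong (_+ sumFin n (erase f a)) (sum-support₁ δ a δ-vanish) ⟩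
      δ a + sumFin n (erase f a)                  ≡⟨ cong (_+ sumFin n (erase f a)) (if-true (==F-refl a)) ⟩
      f a + sumFin n (erase f a)                  ∎
      where
      open ≡-Reasoning
      δ : Fin n → ℚ
      δ u = if u ==F a then f u else 0ℚ
      δ-vanish : ∀ u → u ≢ a → δ u ≡ 0ℚ
      δ-vanish u u≢a = if-false (==F-≢ u≢a)
      split : ∀ u → f u ≡ δ u + erase f a u
      split u with u ==F a
      ... | true = sym (+-identityʳ (f u))
      ... | false = sym (+-identityˡ (f u))

    erase-vanish : ∀ f a u → (u ≢ a → f u ≡ 0ℚ) → erase f a u ≡ 0ℚ
    erase-vanish f a u vanish with u Fin.≟ a
    ... | yes refl = if-true (==F-refl u)
    ... | no u≢a = trans (erase-≢ f u≢a) (vanish u≢a)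

    sum-support₂ : ∀ (f : Fin n → ℚ) a b → a ≢ b → (∀ u → u ≢ a → u ≢ b → f u ≡ 0ℚ) → sumFin n f ≡ f a + f b
    sum-support₂ f a b a≢b vanish = trans (sum-erase f a) (cong (f a +_)
      (trans (sum-support₁ (erase f a) b (λ u u≢b → erase-vanish f a u (λ u≢a → vanish u u≢a u≢b)))
             (erase-≢ f (a≢b ∘ sym))))

    sum-support₃ : ∀ (f : Fin n → ℚ) a b c → a ≢ b → a ≢ c → b ≢ c →
      (∀ u → u ≢ a → u ≢ b → u ≢ c → f u ≡ 0ℚ) → sumFin n f ≡ f a + (f b + f c)
    sum-support₃ f a b c a≢b a≢c b≢c vanish = trans (sum-erase f a) (cong (f a +_)
      (trans (sum-support₂ (erase f a) b c b≢c (λ u u≢b u≢c → erase-vanish f a u (λ u≢a → vanish u u≢a u≢b u≢c)))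
             (cong₂ _+_ (erase-≢ f (a≢b ∘ sym)) (erase-≢ f (a≢c ∘ sym)))))

    sum-support₄ : ∀ (f : Fin n → ℚ) a b c d → a ≢ b → a ≢ c → a ≢ d → b ≢ c → b ≢ d → c ≢ d →
      (∀ u → u ≢ a → u ≢ b → u ≢ c → u ≢ d → f u ≡ 0ℚ) → sumFin n f ≡ f a + (f b + (f c + f d))
    sum-support₄ f a b c d a≢b a≢c a≢d b≢c b≢d c≢d vanish = trans (sum-erase f a) (cong (f a +_)
      (trans (sum-support₃ (erase f a) b c d b≢c b≢d c≢d
                (λ u u≢b u≢c u≢d → erase-vanish f a u (λ u≢a → vanish u u≢a u≢b u≢c u≢d)))
             (cong₂ _+_ (erase-≢ f (a≢b ∘ sym)) (cong₂ _+_ (erase-≢ f (a≢c ∘ sym)) (erase-≢ f (a≢d ∘ sym))))))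

  sum-spike : ∀ n (f : Fin (suc n) → ℚ) a {α β} → f a ≡ α → (∀ u → u ≢ a → f u ≡ β) →
    sumFin (suc n) f ≡ α + fromℕ n * β
  sum-spike n f a {α} {β} fa≡α fu≡β = begin
    sumFin (suc n) f                                    ≡⟨ sum-cong split ⟩
    sumFin (suc n) (λ u → β + g u)                      ≡⟨ sum-+ (λ _ → β) g ⟩
    sumFin (suc n) (λ _ → β) + sumFin (suc n) g         ≡⟨ cong₂ _+_ (sum-const (suc n) β) (sum-support₁ g a g-vanish) ⟩
    (1ℚ + fromℕ n) * β + g a                            ≡⟨ cong ((1ℚ + fromℕ n) * β +_) (if-true (==F-refl a)) ⟩
    (1ℚ + fromℕ n) * β + (α - β)                        ≡⟨ solve 3 (λ α β k → (con 1ℚ :+ k) :* β :+ (α :- β) := α :+ k :* β) refl α β (fromℕ n) ⟩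
    α + fromℕ n * β                                     ∎
    where
    open ≡-Reasoning
    g : Fin (suc n) → ℚ
    g u = if u ==F a then α - β else 0ℚ
    g-vanish : ∀ u → u ≢ a → g u ≡ 0ℚ
    g-vanish u u≢a = if-false (==F-≢ u≢a)
    split : ∀ u → f u ≡ β + g u
    split u with u Fin.≟ a
    ... | yes refl = trans fa≡α (trans (solve 2 (λ α β → α := β :+ (α :- β)) refl α β) (cong (β +_) (sym (if-true (==F-refl u)))))
    ... | no u≢a = trans (fu≡β u u≢a) (trans (sym (+-identityʳ β)) (cong (β +_) (sym (g-vanish u u≢a))))

  0≤erase : ∀ {n} {f : Fin n → ℚ} → (∀ u → 0ℚ ≤ f u) → ∀ a u → 0ℚ ≤ erase f a u
  0≤erase 0≤f a u with u ==F a
  ... | true = ≤-refl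
  ... | false = 0≤f u

  term≤sum : ∀ {n} {f : Fin n → ℚ} → (∀ u → 0ℚ ≤ f u) → ∀ a → f a ≤ sumFin n f
  term≤sum {n} {f} 0≤f a = begin
    f a                            ≡⟨ sym (+-identityʳ (f a)) ⟩
    f a + 0ℚ                       ≡⟨ cong (f a +_) (sym (sum-zero n)) ⟩
    f a + sumFin n (λ _ → 0ℚ)      ≤⟨ +-monoʳ-≤ (f a) (sum-mono-≤ (0≤erase 0≤f a)) ⟩
    f a + sumFin n (erase f a)     ≡⟨ sym (sum-erase f a) ⟩
    sumFin n f                     ∎
    where open ≤-Reasoning

  two-terms≤sum : ∀ {n} {f : Fin n → ℚ} → (∀ u → 0ℚ ≤ f u) → ∀ {a b} → a ≢ b → f a + f b ≤ sumFin n f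
  two-terms≤sum {n} {f} 0≤f {a} {b} a≢b = begin
    f a + f b                      ≡⟨ cong (f a +_) (sym (erase-≢ f (a≢b ∘ sym))) ⟩
    f a + erase f a b              ≤⟨ +-monoʳ-≤ (f a) (term≤sum (0≤erase 0≤f a) b) ⟩
    f a + sumFin n (erase f a)     ≡⟨ sym (sum-erase f a) ⟩
    sumFin n f                     ∎
    where open ≤-Reasoning

  three-terms≤sum : ∀ {n} {f : Fin n → ℚ} → (∀ u → 0ℚ ≤ f u) → ∀ {a b c} → a ≢ b → a ≢ c → b ≢ c →
    f a + (f b + f c) ≤ sumFin n f
  three-terms≤sum {n} {f} 0≤f {a} {b} {c} a≢b a≢c b≢c = begin
    f a + (f b + f c)                         ≡⟨ cong (f a +_) (sym (cong₂ _+_ (erase-≢ f (a≢b ∘ sym)) (erase-≢ f (a≢c ∘ sym)))) ⟩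
    f a + (erase f a b + erase f a c)         ≤⟨ +-monoʳ-≤ (f a) (two-terms≤sum (0≤erase 0≤f a) b≢c) ⟩
    f a + sumFin n (erase f a)                ≡⟨ sym (sum-erase f a) ⟩
    sumFin n f                                ∎
    where open ≤-Reasoning

  -- The summands of netCurrent and cyclicity in Defs are guards, definitionally.
  guard : Bool → ℚ → ℚ
  guard b q = if b then q else 0ℚ

  guard-*ˡ : ∀ b c q → c * guard b q ≡ guard b (c * q)
  guard-*ˡ true c q = refl
  guard-*ˡ false c q = *-zeroʳ c

  guard-+ : ∀ b p q → guard b p + guard b q ≡ guard b (p + q)
  guard-+ true p q = refl
  guard-+ false p q = +-identityˡ 0ℚ

  guard-neg : ∀ b q → guard b (- q) ≡ - guard b q
  guard-neg true q = refl
  guard-neg false q = refl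

  guard-zero : ∀ b → guard b 0ℚ ≡ 0ℚ
  guard-zero true = refl
  guard-zero false = refl

  guard-mono-≤ : ∀ b {p q} → p ≤ q → guard b p ≤ guard b q
  guard-mono-≤ true p≤q = p≤q
  guard-mono-≤ false _ = ≤-refl

  0≤guard : ∀ b {q} → 0ℚ ≤ q → 0ℚ ≤ guard b q
  0≤guard b {q} 0≤q = subst (_≤ guard b q) (guard-zero b) (guard-mono-≤ b 0≤q)

  module _ {n : ℕ} where

    source-at-source : ∀ {i j : Fin n} → source i j i ≡ 1ℚ
    source-at-source {i} = if-true (==F-refl i)

    source-at-sink : ∀ {i j : Fin n} → i ≢ j → source i j j ≡ - 1ℚ
    source-at-sink {j = j} i≢j = trans (if-false (==F-≢ (i≢j ∘ sym))) (if-true (==F-refl j))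

    source-elsewhere : ∀ {i j v : Fin n} → v ≢ i → v ≢ j → source i j v ≡ 0ℚ
    source-elsewhere v≢i v≢j = trans (if-false (==F-≢ v≢i)) (if-false (==F-≢ v≢j))

    source-swap : ∀ {i j : Fin n} → i ≢ j → ∀ v → - source i j v ≡ source j i v
    source-swap {i} {j} i≢j v with v Fin.≟ i | v Fin.≟ j
    ... | yes refl | yes refl = ⊥-elim (i≢j refl)
    ... | yes refl | no v≢j = trans (cong -_ (source-at-source {i = v} {j = j})) (sym (source-at-sink {i = j} {j = v} (v≢j ∘ sym)))
    ... | no v≢i | yes refl = trans (cong -_ (source-at-sink {i = i} {j = v} (v≢i ∘ sym))) (sym (source-at-source {i = v} {j = i}))
    ... | no v≢i | no v≢j = trans (cong -_ (source-elsewhere v≢i v≢j)) (sym (source-elsewhere v≢j v≢i))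

    sum-*source : ∀ {i j : Fin n} → i ≢ j → (y : Fin n → ℚ) → sumFin n (λ v → y v * source i j v) ≡ y i - y j
    sum-*source {i} {j} i≢j y = trans (sum-support₂ _ i j i≢j (λ v v≢i v≢j → trans (cong (y v *_) (source-elsewhere v≢i v≢j)) (*-zeroʳ (y v))))
      (cong₂ _+_ (trans (cong (y i *_) (source-at-source {i = i} {j = j})) (*-identityʳ (y i)))
                 (trans (cong (y j *_) (source-at-sink {i = i} {j = j} i≢j)) (solve 1 (λ y → y :* (:- con 1ℚ) := :- y) refl (y j))))

    source≤0 : ∀ {i j v : Fin n} → v ≢ i → source i j v ≤ 0ℚ
    source≤0 {i} {j} {v} v≢i with v Fin.≟ j
    ... | yes refl = ≤-trans (≤-reflexive (source-at-sink (v≢i ∘ sym))) (neg-antimono-≤ (nonNegative⁻¹ 1ℚ))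
    ... | no v≢j = ≤-reflexive (source-elsewhere v≢i v≢j)

  module Network {n : ℕ} (G : Graph n) (G-sym : ∀ v u → G v u ≡ G u v) where

    divergence : (Fin n → Fin n → ℚ) → Fin n → ℚ
    divergence F v = sumFin n (λ u → guard (G v u) (F v u))

    degree : Fin n → ℚ
    degree v = sumFin n (λ u → guard (G v u) 1ℚ)

    -- A sum over ordered pairs of adjacent vertices: every edge is counted twice.
    edgeSum : (Fin n → Fin n → ℚ) → ℚ
    edgeSum F = sumFin n (divergence F)

    AntisymmetricOnEdges : (Fin n → Fin n → ℚ) → Set
    AntisymmetricOnEdges F = ∀ v u → G v u ≡ true → F v u ≡ - F u v

    grad : (Fin n → ℚ) → Fin n → Fin n → ℚ
    grad y v u = y v - y u

    grad-antisymmetric : ∀ y → AntisymmetricOnEdges (grad y)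
    grad-antisymmetric y v u _ = solve 2 (λ a b → a :- b := :- (b :- a)) refl (y v) (y u)

    edgeSum-+ : ∀ F H → edgeSum F + edgeSum H ≡ edgeSum (λ v u → F v u + H v u)
    edgeSum-+ F H = trans (sym (sum-+ (divergence F) (divergence H)))
      (sum-cong (λ v → trans (sym (sum-+ (λ u → guard (G v u) (F v u)) (λ u → guard (G v u) (H v u))))
                             (sum-cong (λ u → guard-+ (G v u) (F v u) (H v u)))))

    edgeSum-mono-≤ : ∀ {F H} → (∀ v u → F v u ≤ H v u) → edgeSum F ≤ edgeSum H
    edgeSum-mono-≤ F≤H = sum-mono-≤ (λ v → sum-mono-≤ (λ u → guard-mono-≤ (G v u) (F≤H v u)))

    summation-by-parts : ∀ F → AntisymmetricOnEdges F → (y : Fin n → ℚ) →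
      sumFin n (λ v → y v * divergence F v) + sumFin n (λ v → y v * divergence F v) ≡ edgeSum (λ v u → F v u * grad y v u)
    summation-by-parts F anti y = begin
      S + S                  ≡⟨ cong₂ _+_ S≡outflow S≡inflow ⟩
      edgeSum (λ v u → y v * F v u) + edgeSum (λ v u → - (y u * F v u))   ≡⟨ edgeSum-+ _ _ ⟩
      edgeSum (λ v u → y v * F v u + - (y u * F v u))                      ≡⟨ sum-cong (λ v → sum-cong (λ u → cong (guard (G v u))
                               (solve 3 (λ a b f → a :* f :+ (:- (b :* f)) := f :* (a :- b)) refl (y v) (y u) (F v u)))) ⟩
      edgeSum (λ v u → F v u * grad y v u) ∎
      where
      open ≡-Reasoning
      S : ℚ
      S = sumFin n (λ v → y v * divergence F v)
      S≡outflow : S ≡ edgeSum (λ v u → y v * F v u)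
      S≡outflow = sum-cong (λ v → trans (sym (sum-*ˡ (y v) (λ u → guard (G v u) (F v u)))) (sum-cong (λ u → guard-*ˡ (G v u) (y v) (F v u))))
      reverse : ∀ v u → guard (G u v) (y u * F u v) ≡ guard (G v u) (- (y u * F v u))
      reverse v u with G v u in e
      ... | true = trans (cong (λ b → guard b (y u * F u v)) (trans (G-sym u v) e))
                     (trans (cong (y u *_) (anti u v (trans (G-sym u v) e)))
                            (solve 2 (λ a f → a :* (:- f) := :- (a :* f)) refl (y u) (F v u)))
      ... | false = cong (λ b → guard b (y u * F u v)) (trans (G-sym u v) e)
      S≡inflow : S ≡ edgeSum (λ v u → - (y u * F v u))
      S≡inflow = trans S≡outflow (trans (sum-comm n n _) (sum-cong (λ v → sum-cong (λ u → reverse v u))))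

    module _ {i j : Fin n} (i≢j : i ≢ j) where

      IsUnitFlow : (Fin n → Fin n → ℚ) → Set
      IsUnitFlow F = AntisymmetricOnEdges F × (∀ v → divergence F v ≡ source i j v)

      edgeSum-flow*grad : ∀ {F} → IsUnitFlow F → ∀ y → edgeSum (λ v u → F v u * grad y v u) ≡ (y i - y j) + (y i - y j)
      edgeSum-flow*grad {F} (anti , div≡source) y = trans (sym (summation-by-parts F anti y)) (cong₂ _+_ pairing pairing)
        where
        pairing : sumFin n (λ v → y v * divergence F v) ≡ y i - y j
        pairing = trans (sum-cong (λ v → cong (y v *_) (div≡source v))) (sum-*source i≢j y)

      edgeSum-2xy≤x²+y² : ∀ (F H : Fin n → Fin n → ℚ) → edgeSum (λ v u → F v u * H v u) + edgeSum (λ v u → F v u * H v u)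
                                   ≤ edgeSum (λ v u → F v u * F v u) + edgeSum (λ v u → H v u * H v u)
      edgeSum-2xy≤x²+y² F H = begin
        edgeSum FH + edgeSum FH                ≡⟨ edgeSum-+ FH FH ⟩
        edgeSum (λ v u → FH v u + FH v u)      ≤⟨ edgeSum-mono-≤ (λ v u → 2xy≤x²+y² (F v u) (H v u)) ⟩
        edgeSum (λ v u → F v u * F v u + H v u * H v u) ≡⟨ sym (edgeSum-+ _ _) ⟩
        edgeSum (λ v u → F v u * F v u) + edgeSum (λ v u → H v u * H v u) ∎
        where
        open ≤-Reasoning
        FH : Fin n → Fin n → ℚ
        FH v u = F v u * H v u

      module _ (x : Fin n → ℚ) (kirchhoff : ∀ v → netCurrent G x v ≡ source i j v) where

        potential-isUnitFlow : IsUnitFlow (grad x)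
        potential-isUnitFlow = grad-antisymmetric x , kirchhoff

        energy-potential : edgeSum (λ v u → grad x v u * grad x v u) ≡ (x i - x j) + (x i - x j)
        energy-potential = edgeSum-flow*grad potential-isUnitFlow x

        thomson : ∀ {F} → IsUnitFlow F → (x i - x j) + (x i - x j) ≤ edgeSum (λ v u → F v u * F v u)
        thomson {F} flow = +-cancelʳ-≤ (2Ω) (begin
          2Ω + 2Ω                             ≡⟨ sym (cong₂ _+_ cross cross) ⟩
          edgeSum FΔ + edgeSum FΔ             ≤⟨ edgeSum-2xy≤x²+y² F (grad x) ⟩
          edgeSum (λ v u → F v u * F v u) + edgeSum (λ v u → grad x v u * grad x v u) ≡⟨ cong (edgeSum (λ v u → F v u * F v u) +_) energy-potential ⟩
          edgeSum (λ v u → F v u * F v u) + 2Ω ∎)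
          where
          open ≤-Reasoning
          2Ω : ℚ
          2Ω = (x i - x j) + (x i - x j)
          FΔ : Fin n → Fin n → ℚ
          FΔ v u = F v u * grad x v u
          cross : edgeSum FΔ ≡ 2Ω
          cross = edgeSum-flow*grad flow x

        dirichlet : ∀ φ → let d = φ i - φ j in
          (d + d) + (d + d) ≤ ((x i - x j) + (x i - x j)) + edgeSum (λ v u → grad φ v u * grad φ v u)
        dirichlet φ = begin
          (d + d) + (d + d)                   ≡⟨ sym (cong₂ _+_ cross cross) ⟩
          edgeSum ΔΔ + edgeSum ΔΔ             ≤⟨ edgeSum-2xy≤x²+y² (grad x) (grad φ) ⟩
          edgeSum (λ v u → grad x v u * grad x v u) + edgeSum (λ v u → grad φ v u * grad φ v u) ≡⟨ cong (_+ edgeSum (λ v u → grad φ v u * grad φ v u)) energy-potential ⟩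
          ((x i - x j) + (x i - x j)) + edgeSum (λ v u → grad φ v u * grad φ v u) ∎
          where
          open ≤-Reasoning
          d : ℚ
          d = φ i - φ j
          ΔΔ : Fin n → Fin n → ℚ
          ΔΔ v u = grad x v u * grad φ v u
          cross : edgeSum ΔΔ ≡ d + d
          cross = edgeSum-flow*grad potential-isUnitFlow φ

    netCurrent-neg : ∀ x w → netCurrent G (λ v → - x v) w ≡ - netCurrent G x w
    netCurrent-neg x w = trans (sum-cong term) (sum-neg (λ u → guard (G w u) (x w - x u)))
      where
      term : ∀ u → guard (G w u) (- x w - - x u) ≡ - guard (G w u) (x w - x u)
      term u = trans (cong (guard (G w u)) (solve 2 (λ a b → (:- a) :- (:- b) := :- (a :- b)) refl (x w) (x u)))
                     (guard-neg (G w u) (x w - x u))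

    module _ (connected : Connected G) where

      maximum-principle : ∀ (y : Fin n → ℚ) a → (∀ w → w ≢ a → netCurrent G y w ≤ 0ℚ) → ∀ v → y v ≤ y a
      maximum-principle y a subharmonic v with argmax y v
      ... | M , y≤yM = subst (y v ≤_) (sym (spread M (connected M a) refl)) (y≤yM v)
        where
        -- A maximum at w ≢ a spreads to the neighbours of w, since netCurrent G y w ≤ 0 is a sum of nonnegative terms.
        spread : ∀ w → Star (Edge G) w a → y w ≡ y M → y a ≡ y M
        spread w ε yw≡max = yw≡max
        spread w (_◅_ {j = u} w~u u⇝a) yw≡max with w Fin.≟ a
        ... | yes refl = yw≡max
        ... | no w≢a = spread u u⇝a (trans (neighbour≡ u w~u) yw≡max)
          where
          0≤term : ∀ u → 0ℚ ≤ guard (G w u) (y w - y u)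
          0≤term u = 0≤guard (G w u) (p≤q⇒0≤q-p (subst (y u ≤_) (sym yw≡max) (y≤yM u)))
          terms≡0 : ∀ u → 0ℚ ≡ guard (G w u) (y w - y u)
          terms≡0 = sum-≤-≡⇒≡ 0≤term (≤-antisym (sum-mono-≤ 0≤term) (≤-trans (subharmonic w w≢a) (≤-reflexive (sym (sum-zero n)))))
          neighbour≡ : ∀ u → G w u ≡ true → y u ≡ y w
          neighbour≡ u w~u = sym (p-q≡0⇒p≡q (y w) (y u) (sym (trans (terms≡0 u) (cong (λ b → guard b (y w - y u)) w~u))))

      module _ {i j : Fin n} (i≢j : i ≢ j) (x : Fin n → ℚ) (kirchhoff : ∀ v → netCurrent G x v ≡ source i j v) where

        potential-≤-source : ∀ v → x v ≤ x i
        potential-≤-source = maximum-principle x i (λ w w≢i → ≤-trans (≤-reflexive (kirchhoff w)) (source≤0 w≢i))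

        sink-≤-potential : ∀ v → x j ≤ x v
        sink-≤-potential v = neg-cancel-≤ (maximum-principle (λ v → - x v) j subharmonic v)
          where
          subharmonic : ∀ w → w ≢ j → netCurrent G (λ v → - x v) w ≤ 0ℚ
          subharmonic w w≢j = ≤-trans (≤-reflexive (trans (netCurrent-neg x w) (trans (cong -_ (kirchhoff w)) (source-swap i≢j w))))
                                      (source≤0 w≢j)

        resistance-≥2/n : 1ℚ + 1ℚ ≤ fromℕ n * (x i - x j)
        resistance-≥2/n = begin
          1ℚ + 1ℚ                                          ≡⟨ cong₂ _-_ (sym (source-at-source {i = i} {j = j})) (sym (source-at-sink i≢j)) ⟩
          source i j i - source i j j                      ≡⟨ sym (cong₂ _-_ (kirchhoff i) (kirchhoff j)) ⟩
          netCurrent G x i - netCurrent G x j              ≡⟨ cong (netCurrent G x i +_) (sym (sum-neg (outflow j))) ⟩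
          netCurrent G x i + sumFin n (λ u → - outflow j u) ≡⟨ sym (sum-+ (outflow i) (λ u → - outflow j u)) ⟩
          sumFin n (λ u → outflow i u - outflow j u)       ≤⟨ sum-mono-≤ bound ⟩
          sumFin n (λ _ → x i - x j)                       ≡⟨ sum-const n (x i - x j) ⟩
          fromℕ n * (x i - x j)                            ∎
          where
          open ≤-Reasoning
          outflow : Fin n → Fin n → ℚ
          outflow w u = guard (G w u) (x w - x u)
          bound : ∀ u → outflow i u - outflow j u ≤ x i - x j
          bound u with G i u | G j u
          ... | true | true = ≤-reflexive (solve 3 (λ a b c → (a :- b) :- (c :- b) := a :- c) refl (x i) (x u) (x j))
          ... | true | false = ≤-trans (≤-reflexive (+-identityʳ (x i - x u))) (+-monoʳ-≤ (x i) (neg-antimono-≤ (sink-≤-potential u)))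
          ... | false | true = ≤-trans (≤-reflexive (solve 2 (λ b c → con 0ℚ :- (c :- b) := b :- c) refl (x u) (x j)))
                                       (+-monoˡ-≤ (- x j) (potential-≤-source u))
          ... | false | false = p≤q⇒0≤q-p (sink-≤-potential i)

  module ℤMod (n′ : ℕ) where

    n : ℕ
    n = suc n′

    toℕ-mod : ∀ k → toℕ (k mod n) ≡ k % n
    toℕ-mod k = Finₚ.toℕ-fromℕ< _

    mod-cong : ∀ {k l} → k % n ≡ l % n → k mod n ≡ l mod n
    mod-cong {k} {l} eq = Finₚ.toℕ-injective (trans (toℕ-mod k) (trans eq (sym (toℕ-mod l))))

    toℕ-mod-cancel : ∀ a → toℕ a mod n ≡ a
    toℕ-mod-cancel a = Finₚ.toℕ-injective (trans (toℕ-mod (toℕ a)) (m<n⇒m%n≡m (Finₚ.toℕ<n a)))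

    infixl 6 _⊕_

    -- Opaque, as unfolding ⊕ into modular arithmetic makes unification in the flow computations very costly.
    opaque
      _⊕_ : Fin n → Fin n → Fin n
      a ⊕ b = (toℕ a ℕ.+ toℕ b) mod n

      ⊖_ : Fin n → Fin n
      ⊖ a = (n ∸ toℕ a) mod n

      mod-+ : ∀ k l → (k ℕ.+ l) mod n ≡ k mod n ⊕ l mod n
      mod-+ k l = mod-cong {k ℕ.+ l} {toℕ (k mod n) ℕ.+ toℕ (l mod n)} (trans (%-distribˡ-+ k l n) (cong (_% n) (cong₂ ℕ._+_ (sym (toℕ-mod k)) (sym (toℕ-mod l)))))

      ⊕-comm : ∀ a b → a ⊕ b ≡ b ⊕ a
      ⊕-comm a b = cong (_mod n) (ℕₚ.+-comm (toℕ a) (toℕ b))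

      ⊕-assoc : ∀ a b c → (a ⊕ b) ⊕ c ≡ a ⊕ (b ⊕ c)
      ⊕-assoc a b c = begin
        (a ⊕ b) ⊕ c                                ≡⟨ cong ((a ⊕ b) ⊕_) (sym (toℕ-mod-cancel c)) ⟩
        (toℕ a ℕ.+ toℕ b) mod n ⊕ toℕ c mod n      ≡⟨ sym (mod-+ (toℕ a ℕ.+ toℕ b) (toℕ c)) ⟩
        (toℕ a ℕ.+ toℕ b ℕ.+ toℕ c) mod n          ≡⟨ cong (_mod n) (ℕₚ.+-assoc (toℕ a) (toℕ b) (toℕ c)) ⟩
        (toℕ a ℕ.+ (toℕ b ℕ.+ toℕ c)) mod n        ≡⟨ mod-+ (toℕ a) (toℕ b ℕ.+ toℕ c) ⟩
        toℕ a mod n ⊕ (b ⊕ c)                      ≡⟨ cong (_⊕ (b ⊕ c)) (toℕ-mod-cancel a) ⟩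
        a ⊕ (b ⊕ c)                                ∎
        where open ≡-Reasoning

      ⊕-identityˡ : ∀ a → zero ⊕ a ≡ a
      ⊕-identityˡ = toℕ-mod-cancel

      ⊕-inverseʳ : ∀ a → a ⊕ ⊖ a ≡ zero
      ⊕-inverseʳ a = begin
        a ⊕ ⊖ a                               ≡⟨ cong (_⊕ ⊖ a) (sym (toℕ-mod-cancel a)) ⟩
        toℕ a mod n ⊕ (n ∸ toℕ a) mod n       ≡⟨ sym (mod-+ (toℕ a) (n ∸ toℕ a)) ⟩
        (toℕ a ℕ.+ (n ∸ toℕ a)) mod n         ≡⟨ cong (_mod n) (ℕₚ.m+[n∸m]≡n (ℕₚ.<⇒≤ (Finₚ.toℕ<n a))) ⟩
        n mod n                               ≡⟨ mod-cong {n} {0} (n%n≡0 n) ⟩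
        zero                                  ∎
        where open ≡-Reasoning

      toℕ-⊕ : ∀ a b → toℕ (a ⊕ b) ≡ (toℕ a ℕ.+ toℕ b) % n
      toℕ-⊕ a b = toℕ-mod (toℕ a ℕ.+ toℕ b)

      toℕ-⊖ : ∀ a → toℕ (⊖ a) ≡ (n ∸ toℕ a) % n
      toℕ-⊖ a = toℕ-mod (n ∸ toℕ a)

    ⊕-identityʳ : ∀ a → a ⊕ zero ≡ a
    ⊕-identityʳ a = trans (⊕-comm a zero) (⊕-identityˡ a)

    ⊕-inverseˡ : ∀ a → ⊖ a ⊕ a ≡ zero
    ⊕-inverseˡ a = trans (⊕-comm (⊖ a) a) (⊕-inverseʳ a)

    ℤ/nℤ : AbelianGroup _ _
    ℤ/nℤ = record
      { Carrier = Fin n ; _≈_ = _≡_ ; _∙_ = _⊕_ ; ε = zero ; _⁻¹ = ⊖_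
      ; isAbelianGroup = record
        { isGroup = record
          { isMonoid = record
            { isSemigroup = record
              { isMagma = record { isEquivalence = isEquivalence ; ∙-cong = cong₂ _⊕_ }
              ; assoc = ⊕-assoc }
            ; identity = ⊕-identityˡ , ⊕-identityʳ }
          ; inverse = ⊕-inverseˡ , ⊕-inverseʳ
          ; ⁻¹-cong = cong ⊖_ }
        ; comm = ⊕-comm } }

    open AbelianGroupProperties ℤ/nℤ public
      using (identityʳ-unique; ⁻¹-∙-comm; //-rightDividesˡ; //-rightDividesʳ)
      renaming (∙-cancelˡ to ⊕-cancelˡ; ∙-cancelʳ to ⊕-cancelʳ)
    open CommutativeSemigroupProperties (AbelianGroup.commutativeSemigroup ℤ/nℤ) public
      using (interchange)

    k⊕k≢0⇒k≢0 : ∀ k → k ⊕ k ≢ zero → k ≢ zero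
    k⊕k≢0⇒k≢0 k 2k≢0 k≡0 = 2k≢0 (trans (cong₂ _⊕_ k≡0 k≡0) (⊕-identityˡ zero))

    ⊕≢self : ∀ v {k} → k ≢ zero → v ⊕ k ≢ v
    ⊕≢self v {k} k≢0 e = k≢0 (identityʳ-unique v k e)

    ⊖-⊕-cancel : ∀ v k → v ⊕ ⊖ k ⊕ k ≡ v
    ⊖-⊕-cancel v k = //-rightDividesˡ k v

    ⊕-⊖-cancel : ∀ v k → v ⊕ k ⊕ ⊖ k ≡ v
    ⊕-⊖-cancel v k = //-rightDividesʳ k v

    ≡⊕⇒≡⊖ : ∀ {u v} k → v ≡ u ⊕ k → u ≡ v ⊕ ⊖ k
    ≡⊕⇒≡⊖ {u} k refl = sym (⊕-⊖-cancel u k)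

    ≡⊖⇒≡⊕ : ∀ {u v} k → v ⊕ ⊖ k ≡ u → v ≡ u ⊕ k
    ≡⊖⇒≡⊕ {v = v} k refl = sym (⊖-⊕-cancel v k)

    there-and-back : ∀ {u v} k → u ≡ v ⊕ k → v ≡ u ⊕ k → k ⊕ k ≡ zero
    there-and-back {u} {v} k u≡v+k v≡u+k =
      identityʳ-unique v (k ⊕ k) (sym (trans v≡u+k (trans (cong (_⊕ k) u≡v+k) (⊕-assoc v k k))))

    ⊕≡⊕⊖⇒k⊕k≡0 : ∀ v k → v ⊕ k ≡ v ⊕ ⊖ k → k ⊕ k ≡ zero
    ⊕≡⊕⊖⇒k⊕k≡0 v k e = trans (cong (k ⊕_) (⊕-cancelˡ v k (⊖ k) e)) (⊕-inverseʳ k)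

  ∨≡true⇒ : ∀ {a b} → (a ∨ b) ≡ true → a ≡ true ⊎ b ≡ true
  ∨≡true⇒ {true} _ = inj₁ refl
  ∨≡true⇒ {false} h = inj₂ h

  ∧≡true⇒ : ∀ {a b} → (a ∧ b) ≡ true → a ≡ true × b ≡ true
  ∧≡true⇒ {true} {true} _ = refl , refl

  ≢true⇒≡false : ∀ {b} → ¬ (b ≡ true) → b ≡ false
  ≢true⇒≡false {true} h = ⊥-elim (h refl)
  ≢true⇒≡false {false} _ = refl

  module CirculantAdjacency (n′ : ℕ) where
    open ℤMod n′

    toℕ-⊕-mod : ∀ (i : Fin n) k → toℕ (i ⊕ k mod n) ≡ (toℕ i ℕ.+ k) % n
    toℕ-⊕-mod i k = begin
      toℕ (i ⊕ k mod n)                     ≡⟨ toℕ-⊕ i (k mod n) ⟩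
      (toℕ i ℕ.+ toℕ (k mod n)) % n         ≡⟨ cong (λ z → (z ℕ.+ toℕ (k mod n)) % n) (sym (m<n⇒m%n≡m (Finₚ.toℕ<n i))) ⟩
      (toℕ i % n ℕ.+ toℕ (k mod n)) % n     ≡⟨ cong (λ z → (toℕ i % n ℕ.+ z) % n) (toℕ-mod k) ⟩
      (toℕ i % n ℕ.+ k % n) % n             ≡⟨ sym (%-distribˡ-+ (toℕ i) k n) ⟩
      (toℕ i ℕ.+ k) % n                     ∎
      where open ≡-Reasoning

    Jump : Fin n → Fin n → ℕ → Set
    Jump i j k = (k mod n ≢ zero) × (i ⊕ k mod n ≡ j ⊎ j ⊕ k mod n ≡ i)

    private
      nonzero-test⇒≢0 : ∀ k → not ((k % n) ==ℕ 0) ≡ true → k mod n ≢ zero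
      nonzero-test⇒≢0 k h k≡0 with subst (λ z → not (z ==ℕ 0) ≡ true) (trans (sym (toℕ-mod k)) (cong toℕ k≡0)) h
      ... | ()

      ≢0⇒nonzero-test : ∀ k → k mod n ≢ zero → not ((k % n) ==ℕ 0) ≡ true
      ≢0⇒nonzero-test k k≢0 = cong not (==ℕ-≢ (λ e → k≢0 (Finₚ.toℕ-injective (trans (toℕ-mod k) e))))

    shift-test⇒≡ : ∀ (i j : Fin n) k → (((toℕ i ℕ.+ k) % n) ==ℕ toℕ j) ≡ true → i ⊕ k mod n ≡ j
    shift-test⇒≡ i j k h = Finₚ.toℕ-injective (trans (toℕ-⊕-mod i k) (==ℕ⇒≡ h))

    ≡⇒shift-test : ∀ (i j : Fin n) k → i ⊕ k mod n ≡ j → (((toℕ i ℕ.+ k) % n) ==ℕ toℕ j) ≡ true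
    ≡⇒shift-test i j k e = subst (λ z → (z ==ℕ toℕ j) ≡ true) (trans (cong toℕ (sym e)) (toℕ-⊕-mod i k)) (==ℕ-refl (toℕ j))

    adjacent⇒jump : ∀ l (i j : Fin n) → circAdj n l i j ≡ true → ∃ λ k → k ∈ l × Jump i j k
    adjacent⇒jump (k ∷ l) i j h with ∨≡true⇒ h
    ... | inj₂ h′ with adjacent⇒jump l i j h′
    ...   | k′ , k′∈l , jump = k′ , there k′∈l , jump
    adjacent⇒jump (k ∷ l) i j h | inj₁ h′ with ∧≡true⇒ h′
    ... | k≢0 , shifted with ∨≡true⇒ shifted
    ...   | inj₁ forward = k , here refl , nonzero-test⇒≢0 k k≢0 , inj₁ (shift-test⇒≡ i j k forward)
    ...   | inj₂ backward = k , here refl , nonzero-test⇒≢0 k k≢0 , inj₂ (shift-test⇒≡ j i k backward)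

    jump⇒adjacent : ∀ l (i j : Fin n) k → k ∈ l → Jump i j k → circAdj n l i j ≡ true
    jump⇒adjacent (k ∷ l) i j .k (here refl) (k≢0 , shifted) rewrite ≢0⇒nonzero-test k k≢0 with shifted
    ... | inj₁ forward rewrite ≡⇒shift-test i j k forward = refl
    ... | inj₂ backward rewrite ≡⇒shift-test j i k backward | ∨-comm (((toℕ i ℕ.+ k) % n) ==ℕ toℕ j) true = refl
    jump⇒adjacent (k′ ∷ l) i j k (there k∈l) jump rewrite jump⇒adjacent l i j k k∈l jump =
      ∨-zeroʳ (not ((k′ % n) ==ℕ 0) ∧ ((((toℕ i ℕ.+ k′) % n) ==ℕ toℕ j) ∨ (((toℕ j ℕ.+ k′) % n) ==ℕ toℕ i)))

    circAdj-sym : ∀ l (i j : Fin n) → circAdj n l i j ≡ circAdj n l j i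
    circAdj-sym [] i j = refl
    circAdj-sym (k ∷ l) i j rewrite circAdj-sym l i j
      | ∨-comm (((toℕ i ℕ.+ k) % n) ==ℕ toℕ j) (((toℕ j ℕ.+ k) % n) ==ℕ toℕ i) = refl

    circAdj-irrefl : ∀ l (i : Fin n) → circAdj n l i i ≡ false
    circAdj-irrefl l i = ≢true⇒≡false λ adj →
      let (k , _ , k≢0 , shifted) = adjacent⇒jump l i i adj in [ ⊕≢self i k≢0 , ⊕≢self i k≢0 ]′ shifted

    circAdj⇒≢ : ∀ l {i j : Fin n} → circAdj n l i j ≡ true → i ≢ j
    circAdj⇒≢ l {i} adj refl with trans (sym adj) (circAdj-irrefl l i)
    ... | ()

  module CycleAdjacency (n″ : ℕ) where
    open ℤMod (suc n″)
    open CirculantAdjacency (suc n″)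

    one : Fin n
    one = 1 mod n

    one≢zero : one ≢ zero
    one≢zero one≡0 with trans (sym (m<n⇒m%n≡m {n = n} (ℕ.s≤s (ℕ.s≤s ℕ.z≤n)))) (trans (sym (toℕ-mod 1)) (cong toℕ one≡0))
    ... | ()

    cycle⇒step : ∀ P Q → cycleGraph n P Q ≡ true → Q ≡ P ⊕ one ⊎ P ≡ Q ⊕ one
    cycle⇒step P Q adj with ∨≡true⇒ (proj₂ (∧≡true⇒ {not (P ==F Q)} adj))
    ... | inj₁ forward = inj₁ (sym (shift-test⇒≡ P Q 1 forward))
    ... | inj₂ backward = inj₂ (sym (shift-test⇒≡ Q P 1 backward))

    step⇒cycle : ∀ P Q → Q ≡ P ⊕ one ⊎ P ≡ Q ⊕ one → cycleGraph n P Q ≡ true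
    step⇒cycle P Q (inj₁ e) rewrite ==F-≢ (λ P≡Q → ⊕≢self P one≢zero (sym (trans P≡Q e)))
      | ≡⇒shift-test P Q 1 (sym e) = refl
    step⇒cycle P Q (inj₂ e) rewrite ==F-≢ (λ P≡Q → ⊕≢self Q one≢zero (sym (trans (sym P≡Q) e)))
      | ≡⇒shift-test Q P 1 (sym e) | ∨-comm (((toℕ P ℕ.+ 1) % n) ==ℕ toℕ Q) true = refl

  module CirculantGraph (m : ℕ) (l : List ℕ) where
    open ℤMod (suc (suc m)) public
    open CirculantAdjacency (suc (suc m)) public
    open CycleAdjacency (suc m) public

    G : Graph n
    G = Circulant n l

    open Network G (circAdj-sym l) public

    adjacent-⊕ : ∀ {k} → k ∈ l → k mod n ≢ zero → ∀ v → G v (v ⊕ k mod n) ≡ true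
    adjacent-⊕ {k} k∈l K≢0 v = jump⇒adjacent l v (v ⊕ k mod n) k k∈l (K≢0 , inj₁ refl)

    adjacent-⊖ : ∀ {k} → k ∈ l → k mod n ≢ zero → ∀ v → G v (v ⊕ ⊖ (k mod n)) ≡ true
    adjacent-⊖ {k} k∈l K≢0 v = jump⇒adjacent l v (v ⊕ ⊖ (k mod n)) k k∈l (K≢0 , inj₂ (⊖-⊕-cancel v (k mod n)))

    2·one≢0 : one ⊕ one ≢ zero
    2·one≢0 e with trans (sym (m<n⇒m%n≡m {n = n} (ℕ.s≤s (ℕ.s≤s (ℕ.s≤s ℕ.z≤n))))) (trans (sym (toℕ-mod 2)) (cong toℕ (trans (mod-+ 1 1) e)))
    ... | ()

    module JumpFlow {k} (k∈l : k ∈ l) (2K≢0 : k mod n ⊕ k mod n ≢ zero) (i : Fin n) (a b : ℚ) (a+b≡1 : a + b ≡ 1ℚ) where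

      K j : Fin n
      K = k mod n
      j = i ⊕ K

      K≢0 : K ≢ zero
      K≢0 = k⊕k≢0⇒k≢0 K 2K≢0

      i≢j : i ≢ j
      i≢j = ⊕≢self i K≢0 ∘ sym

      ⊕K≢⊖K : ∀ v → v ⊕ K ≢ v ⊕ ⊖ K
      ⊕K≢⊖K v = 2K≢0 ∘ ⊕≡⊕⊖⇒k⊕k≡0 v K

      -- Current a along the edge from i to j, and b backwards along every other edge (v, v ⊕ K).
      c : Fin n → ℚ
      c v = if v ==F i then a else - b

      f : Fin n → Fin n → ℚ
      f v u = if u ==F (v ⊕ K) then c v else (if v ==F (u ⊕ K) then - c u else 0ℚ)

      f-forward : ∀ v → f v (v ⊕ K) ≡ c v
      f-forward v = if-true (==F-refl (v ⊕ K))

      f-backward : ∀ v → f v (v ⊕ ⊖ K) ≡ - c (v ⊕ ⊖ K)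
      f-backward v = trans (if-false (==F-≢ {a = v ⊕ ⊖ K} (⊕K≢⊖K v ∘ sym)))
                           (if-true (subst (λ z → (v ==F z) ≡ true) (sym (⊖-⊕-cancel v K)) (==F-refl v)))

      f-elsewhere : ∀ v u → u ≢ v ⊕ K → u ≢ v ⊕ ⊖ K → f v u ≡ 0ℚ
      f-elsewhere v u u≢v+K u≢v-K = trans (if-false (==F-≢ u≢v+K)) (if-false (==F-≢ {a = v} {b = u ⊕ K} (u≢v-K ∘ ≡⊕⇒≡⊖ K)))

      sum-over-jumps : ∀ (g : Fin n → Fin n → ℚ) → (∀ v u → u ≢ v ⊕ K → u ≢ v ⊕ ⊖ K → g v u ≡ 0ℚ) →
        ∀ v → sumFin n (λ u → guard (G v u) (g v u)) ≡ g v (v ⊕ K) + g v (v ⊕ ⊖ K)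
      sum-over-jumps g vanish v = trans
        (sum-support₂ _ (v ⊕ K) (v ⊕ ⊖ K) (⊕K≢⊖K v) (λ u u≢+ u≢- → trans (cong (guard (G v u)) (vanish v u u≢+ u≢-)) (guard-zero (G v u))))
        (cong₂ _+_ (cong (λ b → guard b (g v (v ⊕ K))) (adjacent-⊕ k∈l K≢0 v))
                   (cong (λ b → guard b (g v (v ⊕ ⊖ K))) (adjacent-⊖ k∈l K≢0 v)))

      f-antisymmetric : AntisymmetricOnEdges f
      f-antisymmetric v u _ with u ==F (v ⊕ K) in e₁ | v ==F (u ⊕ K) in e₂
      ... | true | true = ⊥-elim (2K≢0 (there-and-back K (==F⇒≡ e₁) (==F⇒≡ e₂)))
      ... | true | false = sym (neg-involutive (c v))
      ... | false | true = refl
      ... | false | false = refl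

      divergence-f : ∀ v → divergence f v ≡ source i j v
      divergence-f v = trans (sum-over-jumps f f-elsewhere v)
        (trans (cong₂ _+_ (f-forward v) (f-backward v)) (net v))
        where
        net : ∀ v → c v + - c (v ⊕ ⊖ K) ≡ source i j v
        net v with v Fin.≟ i | v Fin.≟ j
        ... | yes refl | yes v≡j = ⊥-elim (i≢j v≡j)
        ... | yes refl | no _ = begin
          c v + - c (v ⊕ ⊖ K)  ≡⟨ cong₂ (λ x y → x + - y) (if-true (==F-refl v)) (if-false (==F-≢ {a = v ⊕ ⊖ K} {b = v} (i≢j ∘ ≡⊖⇒≡⊕ K))) ⟩
          a + - - b            ≡⟨ trans (cong (a +_) (neg-involutive b)) a+b≡1 ⟩
          1ℚ                   ≡⟨ sym (source-at-source {i = v} {j = j}) ⟩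
          source v j v         ∎
          where open ≡-Reasoning
        ... | no v≢i | yes refl = begin
          c v + - c (v ⊕ ⊖ K)  ≡⟨ cong₂ (λ x y → x + - y) (if-false (==F-≢ v≢i)) (trans (cong c (⊕-⊖-cancel i K)) (if-true (==F-refl i))) ⟩
          - b + - a            ≡⟨ trans (solve 2 (λ a b → (:- b) :+ (:- a) := :- (a :+ b)) refl a b) (cong -_ a+b≡1) ⟩
          - 1ℚ                 ≡⟨ sym (source-at-sink {i = i} {j = v} i≢j) ⟩
          source i v v         ∎
          where open ≡-Reasoning
        ... | no v≢i | no v≢j = begin
          c v + - c (v ⊕ ⊖ K)  ≡⟨ cong₂ (λ x y → x + - y) (if-false (==F-≢ v≢i)) (if-false (==F-≢ {a = v ⊕ ⊖ K} {b = i} (v≢j ∘ ≡⊖⇒≡⊕ K))) ⟩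
          - b + - - b          ≡⟨ +-inverseʳ (- b) ⟩
          0ℚ                   ≡⟨ sym (source-elsewhere v≢i v≢j) ⟩
          source i j v         ∎
          where open ≡-Reasoning

      isUnitFlow : IsUnitFlow i≢j f
      isUnitFlow = f-antisymmetric , divergence-f

      energy : edgeSum (λ v u → f v u * f v u) ≡ (sq a + fromℕ (suc (suc m)) * sq b) + (sq a + fromℕ (suc (suc m)) * sq b)
      energy = begin
        edgeSum (λ v u → f v u * f v u)                       ≡⟨ sum-cong (sum-over-jumps (λ v u → f v u * f v u)
                                                                   (λ v u u≢+ u≢- → cong sq (f-elsewhere v u u≢+ u≢-))) ⟩
        sumFin n (λ v → sq (f v (v ⊕ K)) + sq (f v (v ⊕ ⊖ K))) ≡⟨ sum-cong (λ v → cong₂ _+_ (cong sq (f-forward v))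
                                                                   (trans (cong sq (f-backward v)) (sq-neg (c (v ⊕ ⊖ K))))) ⟩
        sumFin n (λ v → sq (c v) + sq (c (v ⊕ ⊖ K)))           ≡⟨ sum-+ (λ v → sq (c v)) (λ v → sq (c (v ⊕ ⊖ K))) ⟩
        sumFin n (λ v → sq (c v)) + sumFin n (λ v → sq (c (v ⊕ ⊖ K)))
          ≡⟨ cong₂ _+_ (sum-spike (suc (suc m)) (λ v → sq (c v)) i (cong sq (if-true (==F-refl i))) c²-elsewhere)
                       (sum-spike (suc (suc m)) (λ v → sq (c (v ⊕ ⊖ K))) j (trans (cong (sq ∘ c) (⊕-⊖-cancel i K)) (cong sq (if-true (==F-refl i))))
                                  (λ u u≢j → c²-elsewhere (u ⊕ ⊖ K) (u≢j ∘ ≡⊖⇒≡⊕ K))) ⟩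
        (sq a + fromℕ (suc (suc m)) * sq b) + (sq a + fromℕ (suc (suc m)) * sq b) ∎
        where
        open ≡-Reasoning
        c²-elsewhere : ∀ u → u ≢ i → sq (c u) ≡ sq b
        c²-elsewhere u u≢i = trans (cong sq (if-false (==F-≢ u≢i))) (sq-neg b)

    module AntipodalFlow {k t} (k∈l : k ∈ l) (K≢0 : k mod n ≢ zero) (2K≡0 : k mod n ⊕ k mod n ≡ zero)
                         (t∈l : t ∈ l) (2T≢0 : t mod n ⊕ t mod n ≢ zero) (i : Fin n) (a b : ℚ) (a+b≡1 : a + b ≡ 1ℚ) where

      K T j p q : Fin n
      K = k mod n
      T = t mod n
      j = i ⊕ K
      p = i ⊕ T
      q = j ⊕ T

      T≢0 : T ≢ zero
      T≢0 = k⊕k≢0⇒k≢0 T 2T≢0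

      T≢K : T ≢ K
      T≢K T≡K = 2T≢0 (trans (cong₂ _⊕_ T≡K T≡K) 2K≡0)

      K⊕T≢0 : K ⊕ T ≢ zero
      K⊕T≢0 e = T≢K (⊕-cancelˡ K T K (trans e (sym 2K≡0)))

      ⊕K⊕K : ∀ v → v ⊕ K ⊕ K ≡ v
      ⊕K⊕K v = trans (⊕-assoc v K K) (trans (cong (v ⊕_) 2K≡0) (⊕-identityʳ v))

      ⊕K-flip : ∀ {w z} → w ⊕ K ≡ z → w ≡ z ⊕ K
      ⊕K-flip {w} e = trans (sym (⊕K⊕K w)) (cong (_⊕ K) e)

      i≢j : i ≢ j
      i≢j = ⊕≢self i K≢0 ∘ sym
      i≢p : i ≢ p
      i≢p = ⊕≢self i T≢0 ∘ sym
      i≢q : i ≢ q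
      i≢q e = ⊕≢self i K⊕T≢0 (sym (trans e (⊕-assoc i K T)))
      j≢p : j ≢ p
      j≢p e = T≢K (sym (⊕-cancelˡ i K T e))
      j≢q : j ≢ q
      j≢q = ⊕≢self j T≢0 ∘ sym
      p≢q : p ≢ q
      p≢q e = i≢j (⊕-cancelʳ T i j e)

      p⊕K : p ⊕ K ≡ q
      p⊕K = trans (⊕-assoc i T K) (trans (cong (i ⊕_) (⊕-comm T K)) (sym (⊕-assoc i K T)))

      -- g lives on T-edges and h on K-edges: current a along i → j and b along the path i → p → q → j.
      g s h : Fin n → ℚ
      g v = if v ==F i then b else (if v ==F j then - b else 0ℚ)
      s v = if v ==F i then a else (if v ==F p then b else 0ℚ)
      h v = s v - s (v ⊕ K)

      g-i : g i ≡ b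
      g-i = if-true (==F-refl i)
      g-j : g j ≡ - b
      g-j = trans (if-false (==F-≢ (i≢j ∘ sym))) (if-true (==F-refl j))
      g-elsewhere : ∀ {v} → v ≢ i → v ≢ j → g v ≡ 0ℚ
      g-elsewhere v≢i v≢j = trans (if-false (==F-≢ v≢i)) (if-false (==F-≢ v≢j))

      s-i : s i ≡ a
      s-i = if-true (==F-refl i)
      s-p : s p ≡ b
      s-p = trans (if-false (==F-≢ (i≢p ∘ sym))) (if-true (==F-refl p))
      s-elsewhere : ∀ {v} → v ≢ i → v ≢ p → s v ≡ 0ℚ
      s-elsewhere v≢i v≢p = trans (if-false (==F-≢ v≢i)) (if-false (==F-≢ v≢p))

      h-⊕K : ∀ v → h (v ⊕ K) ≡ - h v
      h-⊕K v = trans (cong (λ w → s (v ⊕ K) - s w) (⊕K⊕K v)) (solve 2 (λ x y → y :- x := :- (x :- y)) refl (s v) (s (v ⊕ K)))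

      h-i : h i ≡ a
      h-i = trans (cong₂ _-_ s-i (s-elsewhere (i≢j ∘ sym) j≢p)) (+-identityʳ a)
      h-j : h j ≡ - a
      h-j = trans (h-⊕K i) (cong -_ h-i)
      h-p : h p ≡ b
      h-p = trans (cong₂ _-_ s-p (trans (cong s p⊕K) (s-elsewhere (i≢q ∘ sym) (p≢q ∘ sym)))) (+-identityʳ b)
      h-q : h q ≡ - b
      h-q = trans (cong h (sym p⊕K)) (trans (h-⊕K p) (cong -_ h-p))
      h-elsewhere : ∀ {v} → v ≢ i → v ≢ j → v ≢ p → v ≢ q → h v ≡ 0ℚ
      h-elsewhere {v} v≢i v≢j v≢p v≢q = trans (cong₂ _-_ (s-elsewhere v≢i v≢p)
        (s-elsewhere (v≢j ∘ ⊕K-flip) (v≢q ∘ (λ e → trans (⊕K-flip e) p⊕K)))) (+-identityʳ 0ℚ)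

      f : Fin n → Fin n → ℚ
      f v u = if u ==F (v ⊕ T) then g v else (if v ==F (u ⊕ T) then - g u else (if u ==F (v ⊕ K) then h v else 0ℚ))

      f-antisymmetric : AntisymmetricOnEdges f
      f-antisymmetric v u _ with u ==F (v ⊕ T) in e₁ | v ==F (u ⊕ T) in e₂ | u ==F (v ⊕ K) in e₃ | v ==F (u ⊕ K) in e₄
      ... | true | true | _ | _ = ⊥-elim (2T≢0 (there-and-back T (==F⇒≡ e₁) (==F⇒≡ e₂)))
      ... | true | false | _ | _ = sym (neg-involutive (g v))
      ... | false | true | _ | _ = refl
      ... | false | false | true | true = trans (sym (neg-involutive (h v))) (cong -_ (sym (trans (cong h (==F⇒≡ e₃)) (h-⊕K v))))
      ... | false | false | true | false = ⊥-elim (==F-false⇒≢ e₄ (sym (trans (cong (_⊕ K) (==F⇒≡ e₃)) (⊕K⊕K v))))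
      ... | false | false | false | true = ⊥-elim (==F-false⇒≢ e₃ (sym (trans (cong (_⊕ K) (==F⇒≡ e₄)) (⊕K⊕K u))))
      ... | false | false | false | false = refl

      +T≢-T : ∀ v → v ⊕ T ≢ v ⊕ ⊖ T
      +T≢-T v = 2T≢0 ∘ ⊕≡⊕⊖⇒k⊕k≡0 v T
      +T≢+K : ∀ v → v ⊕ T ≢ v ⊕ K
      +T≢+K v = T≢K ∘ ⊕-cancelˡ v T K
      -T≢+K : ∀ v → v ⊕ ⊖ T ≢ v ⊕ K
      -T≢+K v e = K⊕T≢0 (trans (cong (_⊕ T) (sym (⊕-cancelˡ v (⊖ T) K e))) (⊕-inverseˡ T))

      f-+T : ∀ v → f v (v ⊕ T) ≡ g v
      f-+T v = if-true (==F-refl (v ⊕ T))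
      f--T : ∀ v → f v (v ⊕ ⊖ T) ≡ - g (v ⊕ ⊖ T)
      f--T v = trans (if-false (==F-≢ {a = v ⊕ ⊖ T} (+T≢-T v ∘ sym)))
                     (if-true (subst (λ z → (v ==F z) ≡ true) (sym (⊖-⊕-cancel v T)) (==F-refl v)))
      f-+K : ∀ v → f v (v ⊕ K) ≡ h v
      f-+K v = trans (if-false (==F-≢ {a = v ⊕ K} (+T≢+K v ∘ sym)))
               (trans (if-false (==F-≢ {a = v} {b = v ⊕ K ⊕ T} (λ e → K⊕T≢0 (identityʳ-unique v (K ⊕ T) (sym (trans e (⊕-assoc v K T)))))))
                      (if-true (==F-refl (v ⊕ K))))
      f-elsewhere : ∀ v u → u ≢ v ⊕ T → u ≢ v ⊕ ⊖ T → u ≢ v ⊕ K → f v u ≡ 0ℚ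
      f-elsewhere v u u≢+T u≢-T u≢+K = trans (if-false (==F-≢ u≢+T))
        (trans (if-false (==F-≢ {a = v} {b = u ⊕ T} (u≢-T ∘ ≡⊕⇒≡⊖ T))) (if-false (==F-≢ u≢+K)))

      sum-over-jumps : ∀ (F : Fin n → Fin n → ℚ) → (∀ v u → u ≢ v ⊕ T → u ≢ v ⊕ ⊖ T → u ≢ v ⊕ K → F v u ≡ 0ℚ) →
        ∀ v → sumFin n (λ u → guard (G v u) (F v u)) ≡ F v (v ⊕ T) + (F v (v ⊕ ⊖ T) + F v (v ⊕ K))
      sum-over-jumps F vanish v = trans
        (sum-support₃ _ (v ⊕ T) (v ⊕ ⊖ T) (v ⊕ K) (+T≢-T v) (+T≢+K v) (-T≢+K v)
          (λ u u≢+T u≢-T u≢+K → trans (cong (guard (G v u)) (vanish v u u≢+T u≢-T u≢+K)) (guard-zero (G v u))))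
        (cong₂ _+_ (cong (λ b → guard b (F v (v ⊕ T))) (adjacent-⊕ t∈l T≢0 v))
          (cong₂ _+_ (cong (λ b → guard b (F v (v ⊕ ⊖ T))) (adjacent-⊖ t∈l T≢0 v))
                     (cong (λ b → guard b (F v (v ⊕ K))) (adjacent-⊕ k∈l K≢0 v))))

      divergence-f : ∀ v → divergence f v ≡ source i j v
      divergence-f v = trans (sum-over-jumps f f-elsewhere v)
        (trans (cong₂ _+_ (f-+T v) (cong₂ _+_ (f--T v) (f-+K v))) (net v))
        where
        net : ∀ v → g v + (- g (v ⊕ ⊖ T) + h v) ≡ source i j v
        net v with v Fin.≟ i | v Fin.≟ j | v Fin.≟ p | v Fin.≟ q
        ... | yes refl | _ | _ | _ =
          trans (cong₂ (λ x y → x + (- y + h i)) g-i (g-elsewhere (⊕≢self i T≢0 ∘ sym ∘ ≡⊖⇒≡⊕ T) (i≢q ∘ ≡⊖⇒≡⊕ T)))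
            (trans (cong (λ x → b + (- 0ℚ + x)) h-i)
              (trans (solve 2 (λ a b → b :+ (:- con 0ℚ :+ a) := a :+ b) refl a b) (trans a+b≡1 (sym (source-at-source {i = i} {j = j})))))
        ... | no _ | yes refl | _ | _ =
          trans (cong₂ (λ x y → x + (- y + h j)) g-j (g-elsewhere (j≢p ∘ ≡⊖⇒≡⊕ T) (⊕≢self j T≢0 ∘ sym ∘ ≡⊖⇒≡⊕ T)))
            (trans (cong (λ x → - b + (- 0ℚ + x)) h-j)
              (trans (solve 2 (λ a b → (:- b) :+ (:- con 0ℚ :+ (:- a)) := :- (a :+ b)) refl a b)
                (trans (cong -_ a+b≡1) (sym (source-at-sink i≢j)))))
        ... | no v≢i | no v≢j | yes refl | _ =
          trans (cong₂ (λ x y → x + (- y + h p)) (g-elsewhere v≢i v≢j) (trans (cong g (⊕-⊖-cancel i T)) g-i))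
            (trans (cong (λ x → 0ℚ + (- b + x)) h-p)
              (trans (solve 1 (λ b → con 0ℚ :+ (:- b :+ b) := con 0ℚ) refl b) (sym (source-elsewhere v≢i v≢j))))
        ... | no v≢i | no v≢j | no _ | yes refl =
          trans (cong₂ (λ x y → x + (- y + h q)) (g-elsewhere v≢i v≢j) (trans (cong g (⊕-⊖-cancel j T)) g-j))
            (trans (cong (λ x → 0ℚ + (- - b + x)) h-q)
              (trans (solve 1 (λ b → con 0ℚ :+ (:- (:- b) :+ (:- b)) := con 0ℚ) refl b) (sym (source-elsewhere v≢i v≢j))))
        ... | no v≢i | no v≢j | no v≢p | no v≢q =
          trans (cong₂ (λ x y → x + (- y + h v)) (g-elsewhere v≢i v≢j) (g-elsewhere (v≢p ∘ ≡⊖⇒≡⊕ T) (v≢q ∘ ≡⊖⇒≡⊕ T)))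
            (trans (cong (λ x → 0ℚ + (- 0ℚ + x)) (h-elsewhere v≢i v≢j v≢p v≢q)) (sym (source-elsewhere v≢i v≢j)))

      isUnitFlow : IsUnitFlow i≢j f
      isUnitFlow = f-antisymmetric , divergence-f

      energy : edgeSum (λ v u → f v u * f v u) ≡ (sq a + (sq b + (sq b + sq b))) + (sq a + (sq b + (sq b + sq b)))
      energy = begin
        edgeSum (λ v u → f v u * f v u)
          ≡⟨ sum-cong (sum-over-jumps (λ v u → f v u * f v u) (λ v u u≢+T u≢-T u≢+K → cong sq (f-elsewhere v u u≢+T u≢-T u≢+K))) ⟩
        sumFin n (λ v → sq (f v (v ⊕ T)) + (sq (f v (v ⊕ ⊖ T)) + sq (f v (v ⊕ K))))
          ≡⟨ sum-cong (λ v → cong₂ _+_ (cong sq (f-+T v)) (cong₂ _+_ (trans (cong sq (f--T v)) (sq-neg (g (v ⊕ ⊖ T)))) (cong sq (f-+K v)))) ⟩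
        sumFin n (λ v → sq (g v) + (sq (g (v ⊕ ⊖ T)) + sq (h v)))
          ≡⟨ trans (sum-+ (λ v → sq (g v)) (λ v → sq (g (v ⊕ ⊖ T)) + sq (h v))) (cong (sumFin n (λ v → sq (g v)) +_) (sum-+ (λ v → sq (g (v ⊕ ⊖ T))) (λ v → sq (h v)))) ⟩
        sumFin n (λ v → sq (g v)) + (sumFin n (λ v → sq (g (v ⊕ ⊖ T))) + sumFin n (λ v → sq (h v)))
          ≡⟨ cong₂ _+_ Σg² (cong₂ _+_ Σg²-shifted Σh²) ⟩
        (sq b + sq b) + ((sq b + sq b) + (sq a + (sq a + (sq b + sq b))))
          ≡⟨ solve 2 (λ a b → (b :* b :+ b :* b) :+ ((b :* b :+ b :* b) :+ (a :* a :+ (a :* a :+ (b :* b :+ b :* b))))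
                              := (a :* a :+ (b :* b :+ (b :* b :+ b :* b))) :+ (a :* a :+ (b :* b :+ (b :* b :+ b :* b)))) refl a b ⟩
        (sq a + (sq b + (sq b + sq b))) + (sq a + (sq b + (sq b + sq b))) ∎
        where
        open ≡-Reasoning
        Σg² : sumFin n (λ v → sq (g v)) ≡ sq b + sq b
        Σg² = trans (sum-support₂ (λ v → sq (g v)) i j i≢j (λ u u≢i u≢j → cong sq (g-elsewhere u≢i u≢j)))
                    (cong₂ _+_ (cong sq g-i) (trans (cong sq g-j) (sq-neg b)))
        Σg²-shifted : sumFin n (λ v → sq (g (v ⊕ ⊖ T))) ≡ sq b + sq b
        Σg²-shifted = trans (sum-support₂ (λ v → sq (g (v ⊕ ⊖ T))) p q p≢q (λ u u≢p u≢q → cong sq (g-elsewhere (u≢p ∘ ≡⊖⇒≡⊕ T) (u≢q ∘ ≡⊖⇒≡⊕ T))))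
          (cong₂ _+_ (cong sq (trans (cong g (⊕-⊖-cancel i T)) g-i)) (trans (cong sq (trans (cong g (⊕-⊖-cancel j T)) g-j)) (sq-neg b)))
        Σh² : sumFin n (λ v → sq (h v)) ≡ sq a + (sq a + (sq b + sq b))
        Σh² = trans (sum-support₄ (λ v → sq (h v)) i j p q i≢j i≢p i≢q j≢p j≢q p≢q (λ u u≢i u≢j u≢p u≢q → cong sq (h-elsewhere u≢i u≢j u≢p u≢q)))
          (cong₂ _+_ (cong sq h-i) (cong₂ _+_ (trans (cong sq h-j) (sq-neg a)) (cong₂ _+_ (cong sq h-p) (trans (cong sq h-q) (sq-neg b)))))

  antipodal⇒3n/4≤n-1 : ∀ m (K : Fin (suc (suc (suc m)))) → K ≢ zero → ℤMod._⊕_ (suc (suc m)) K K ≡ zero →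
    fromℕ (suc (suc (suc m))) * (ℤ.+ 3 ℚ./ 4) ≤ fromℕ (suc (suc m))
  antipodal⇒3n/4≤n-1 zero zero K≢0 _ = ⊥-elim (K≢0 refl)
  antipodal⇒3n/4≤n-1 zero K@(suc zero) _ 2K≡0 with trans (sym (ℤMod.toℕ-⊕ 2 K K)) (cong toℕ 2K≡0)
  ... | ()
  antipodal⇒3n/4≤n-1 zero K@(suc (suc zero)) _ 2K≡0 with trans (sym (ℤMod.toℕ-⊕ 2 K K)) (cong toℕ 2K≡0)
  ... | ()
  antipodal⇒3n/4≤n-1 (suc r) _ _ _ = begin
    fromℕ (4 ℕ.+ r) * ¾                ≡⟨ trans (cong (_* ¾) (fromℕ-+ 4 r)) (*-distribʳ-+ ¾ (fromℕ 4) (fromℕ r)) ⟩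
    fromℕ 3 + fromℕ r * ¾              ≤⟨ +-monoʳ-≤ (fromℕ 3) (subst (fromℕ r * ¾ ≤_) (*-identityʳ (fromℕ r))
                                            (*-monoˡ-≤-0≤ (0≤fromℕ r) (ℚ.*≤* (ℤ.+≤+ (ℕ.s≤s (ℕ.s≤s (ℕ.s≤s ℕ.z≤n))))))) ⟩
    fromℕ 3 + fromℕ r                  ≡⟨ sym (fromℕ-+ 3 r) ⟩
    fromℕ (3 ℕ.+ r)                    ∎
    where
    open ≤-Reasoning
    ¾ : ℚ
    ¾ = ℤ.+ 3 ℚ./ 4

  module EdgeResistance (m : ℕ) (l : List ℕ) (connected : Connected (Circulant (suc (suc (suc m))) l)) where
    open CirculantGraph m l

    jump-of-order>2 : ∃ λ t → t ∈ l × t mod n ⊕ t mod n ≢ zero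
    jump-of-order>2 with any? (λ t → ¬? (t mod n ⊕ t mod n Fin.≟ zero)) l
    ... | yes found = find found
    ... | no none = ⊥-elim (2·one≢0 (reach (connected zero one) (⊕-identityˡ zero)))
      where
      order≤2 : ∀ {t} → t ∈ l → t mod n ⊕ t mod n ≡ zero
      order≤2 t∈l = decidable-stable (_ Fin.≟ zero) (none ∘ lose t∈l)
      reach : ∀ {w w′} → Star (Edge G) w w′ → w ⊕ w ≡ zero → w′ ⊕ w′ ≡ zero
      reach ε 2w≡0 = 2w≡0
      reach {w} (_◅_ {j = u} w~u u⇝w′) 2w≡0 with adjacent⇒jump l w u w~u
      ... | t , t∈l , _ , inj₁ w+T≡u = reach u⇝w′ (begin
        u ⊕ u                              ≡⟨ cong (λ z → z ⊕ z) (sym w+T≡u) ⟩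
        (w ⊕ t mod n) ⊕ (w ⊕ t mod n)      ≡⟨ interchange w (t mod n) w (t mod n) ⟩
        (w ⊕ w) ⊕ (t mod n ⊕ t mod n)      ≡⟨ cong₂ _⊕_ 2w≡0 (order≤2 t∈l) ⟩
        zero ⊕ zero                        ≡⟨ ⊕-identityˡ zero ⟩
        zero                               ∎)
        where open ≡-Reasoning
      ... | t , t∈l , _ , inj₂ u+T≡w = reach u⇝w′ (⊕-cancelʳ (t mod n ⊕ t mod n) (u ⊕ u) zero (begin
        (u ⊕ u) ⊕ (t mod n ⊕ t mod n)      ≡⟨ sym (interchange u (t mod n) u (t mod n)) ⟩
        (u ⊕ t mod n) ⊕ (u ⊕ t mod n)      ≡⟨ cong (λ z → z ⊕ z) u+T≡w ⟩
        w ⊕ w                              ≡⟨ trans 2w≡0 (sym (order≤2 t∈l)) ⟩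
        t mod n ⊕ t mod n                  ≡⟨ sym (⊕-identityˡ _) ⟩
        zero ⊕ (t mod n ⊕ t mod n)         ∎))
        where open ≡-Reasoning

    module _ {k} (k∈l : k ∈ l) (K≢0 : k mod n ≢ zero) (i : Fin n) (x : Fin n → ℚ)
             (kirchhoff : ∀ v → netCurrent G x v ≡ source i (i ⊕ k mod n) v) where

      Ω : ℚ
      Ω = x i - x (i ⊕ k mod n)

      jump-resistance-≤ : fromℕ n * Ω ≤ fromℕ (suc (suc m))
      jump-resistance-≤ with k mod n ⊕ k mod n Fin.≟ zero
      ... | no 2K≢0 = begin
        fromℕ n * Ω   ≤⟨ *-monoˡ-≤-0≤ (0≤fromℕ n) (x+x≤y+y⇒x≤y (≤-trans (thomson i≢j x kirchhoff isUnitFlow) (≤-reflexive energy))) ⟩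
        fromℕ n * E   ≡⟨ n·E≡n-1 ⟩
        fromℕ (suc (suc m)) ∎
        where
        open ≤-Reasoning
        a b N E : ℚ
        b = 1/suc (suc (suc m))
        a = 1ℚ - b
        N = fromℕ (suc (suc m))
        E = sq a + N * sq b
        open JumpFlow k∈l 2K≢0 i a b (solve 1 (λ b → (con 1ℚ :- b) :+ b := con 1ℚ) refl b)
        n·E≡n-1 : fromℕ n * E ≡ N
        n·E≡n-1 = begin-equality
          (1ℚ + N) * ((1ℚ - b) * (1ℚ - b) + N * (b * b))
            ≡⟨ solve 2 (λ N b → (con 1ℚ :+ N) :* ((con 1ℚ :- b) :* (con 1ℚ :- b) :+ N :* (b :* b))
                         := N :+ ((con 1ℚ :+ N) :* b :- con 1ℚ) :* ((con 1ℚ :+ N) :* b :- con 1ℚ)) refl N b ⟩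
          N + ((1ℚ + N) * b - 1ℚ) * ((1ℚ + N) * b - 1ℚ)
            ≡⟨ cong (λ z → N + (z - 1ℚ) * (z - 1ℚ)) (fromℕ-suc*1/suc (suc (suc m))) ⟩
          N + (1ℚ - 1ℚ) * (1ℚ - 1ℚ)  ≡⟨ solve 1 (λ N → N :+ (con 1ℚ :- con 1ℚ) :* (con 1ℚ :- con 1ℚ) := N) refl N ⟩
          N ∎
      ... | yes 2K≡0 with jump-of-order>2
      ... | t , t∈l , 2T≢0 = begin
        fromℕ n * Ω   ≤⟨ *-monoˡ-≤-0≤ (0≤fromℕ n) (x+x≤y+y⇒x≤y (≤-trans (thomson i≢j x kirchhoff isUnitFlow) (≤-reflexive energy))) ⟩
        fromℕ n * ¾   ≤⟨ antipodal⇒3n/4≤n-1 m (k mod n) K≢0 2K≡0 ⟩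
        fromℕ (suc (suc m)) ∎
        where
        open ≤-Reasoning
        ¾ : ℚ
        ¾ = ℤ.+ 3 ℚ./ 4
        open AntipodalFlow k∈l K≢0 2K≡0 t∈l 2T≢0 i ¾ (ℤ.+ 1 ℚ./ 4) refl

    edge-resistance-≤ : ∀ {i j} → G i j ≡ true → ∀ (x : Fin n → ℚ) → (∀ v → netCurrent G x v ≡ source i j v) →
      fromℕ n * (x i - x j) ≤ fromℕ (suc (suc m))
    edge-resistance-≤ {i} {j} i~j x kirchhoff with adjacent⇒jump l i j i~j
    ... | k , k∈l , K≢0 , inj₁ refl = jump-resistance-≤ k∈l K≢0 i x kirchhoff
    ... | k , k∈l , K≢0 , inj₂ refl = subst (λ z → fromℕ n * z ≤ fromℕ (suc (suc m)))
        (solve 2 (λ a b → (:- a) :- (:- b) := b :- a) refl (x j) (x (j ⊕ k mod n)))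
        (jump-resistance-≤ k∈l K≢0 j (λ v → - x v) reversed)
      where
      reversed : ∀ v → netCurrent G (λ v → - x v) v ≡ source j (j ⊕ k mod n) v
      reversed v = trans (netCurrent-neg x v) (trans (cong -_ (kirchhoff v))
                     (source-swap (⊕≢self j K≢0) v))

  module CycleResistance (m : ℕ) (l : List ℕ) (σ : Permutation′ (suc (suc (suc m))))
    (σ-iso : ∀ v u → Circulant (suc (suc (suc m))) l v u ≡ cycleGraph (suc (suc (suc m))) (σ ⟨$⟩ʳ v) (σ ⟨$⟩ʳ u)) where
    open CirculantGraph m l

    cycle-+1 : ∀ P → cycleGraph n P (P ⊕ one) ≡ true
    cycle-+1 P = step⇒cycle P (P ⊕ one) (inj₁ refl)

    cycle--1 : ∀ P → cycleGraph n P (P ⊕ ⊖ one) ≡ true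
    cycle--1 P = step⇒cycle P (P ⊕ ⊖ one) (inj₂ (sym (⊖-⊕-cancel P one)))

    cycle-elsewhere : ∀ P w → w ≢ P ⊕ one → w ≢ P ⊕ ⊖ one → cycleGraph n P w ≡ false
    cycle-elsewhere P w w≢+1 w≢-1 = ≢true⇒≡false λ adj → case (cycle⇒step P w adj)
      where
      case : w ≡ P ⊕ one ⊎ P ≡ w ⊕ one → _
      case (inj₁ e) = w≢+1 e
      case (inj₂ e) = w≢-1 (≡⊕⇒≡⊖ one e)

    +1≢-1 : ∀ P → P ⊕ one ≢ P ⊕ ⊖ one
    +1≢-1 P = 2·one≢0 ∘ ⊕≡⊕⊖⇒k⊕k≡0 P one

    sum-over-cycle-neighbours : ∀ P (F : Fin n → ℚ) → sumFin n (λ w → guard (cycleGraph n P w) (F w)) ≡ F (P ⊕ one) + F (P ⊕ ⊖ one)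
    sum-over-cycle-neighbours P F = trans
      (sum-support₂ _ (P ⊕ one) (P ⊕ ⊖ one) (+1≢-1 P) (λ w w≢+1 w≢-1 → cong (λ b → guard b (F w)) (cycle-elsewhere P w w≢+1 w≢-1)))
      (cong₂ _+_ (cong (λ b → guard b (F (P ⊕ one))) (cycle-+1 P)) (cong (λ b → guard b (F (P ⊕ ⊖ one))) (cycle--1 P)))

    σ-neighbours : ∀ v (F : Fin n → ℚ) → sumFin n (λ u → guard (G v u) (F (σ ⟨$⟩ʳ u))) ≡ F ((σ ⟨$⟩ʳ v) ⊕ one) + F ((σ ⟨$⟩ʳ v) ⊕ ⊖ one)
    σ-neighbours v F = begin
      sumFin n (λ u → guard (G v u) (F (σ ⟨$⟩ʳ u)))                          ≡⟨ sum-cong (λ u → cong (λ b → guard b (F (σ ⟨$⟩ʳ u))) (σ-iso v u)) ⟩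
      sumFin n (λ u → guard (cycleGraph n (σ ⟨$⟩ʳ v) (σ ⟨$⟩ʳ u)) (F (σ ⟨$⟩ʳ u))) ≡⟨ sum-permute σ (λ w → guard (cycleGraph n (σ ⟨$⟩ʳ v) w) (F w)) ⟩
      sumFin n (λ w → guard (cycleGraph n (σ ⟨$⟩ʳ v) w) (F w))                 ≡⟨ sum-over-cycle-neighbours (σ ⟨$⟩ʳ v) F ⟩
      F ((σ ⟨$⟩ʳ v) ⊕ one) + F ((σ ⟨$⟩ʳ v) ⊕ ⊖ one)                                 ∎
      where open ≡-Reasoning

    degree≡2 : ∀ v → degree v ≡ 1ℚ + 1ℚ
    degree≡2 v = σ-neighbours v (λ _ → 1ℚ)

    edgeSum-σ : ∀ (F : Fin n → Fin n → ℚ) →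
      edgeSum (λ v u → F (σ ⟨$⟩ʳ v) (σ ⟨$⟩ʳ u)) ≡ sumFin n (λ P → F P (P ⊕ one) + F P (P ⊕ ⊖ one))
    edgeSum-σ F = trans (sum-cong (λ v → σ-neighbours v (F (σ ⟨$⟩ʳ v))))
                        (sum-permute σ (λ P → F P (P ⊕ one) + F P (P ⊕ ⊖ one)))

    toℕ-one : toℕ one ≡ 1
    toℕ-one = trans (toℕ-mod 1) (m<n⇒m%n≡m {n = n} (ℕ.s≤s (ℕ.s≤s ℕ.z≤n)))

    toℕ-⊖one : toℕ (⊖ one) ≡ suc (suc m)
    toℕ-⊖one = trans (toℕ-⊖ one) (trans (cong (λ z → (n ∸ z) % n) toℕ-one) (m<n⇒m%n≡m {n = n} (ℕₚ.n<1+n (suc (suc m)))))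

    toℕ-⊕one : ∀ y → y ≢ ⊖ one → toℕ (y ⊕ one) ≡ suc (toℕ y)
    toℕ-⊕one y y≢-1 = trans (toℕ-⊕-mod y 1) (trans (m<n⇒m%n≡m {n = n} y+1<n) (ℕₚ.+-comm (toℕ y) 1))
      where
      y+1<n : toℕ y ℕ.+ 1 ℕ.< n
      y+1<n = subst (ℕ._< n) (ℕₚ.+-comm 1 (toℕ y))
        (ℕ.s≤s (ℕₚ.≤∧≢⇒< (ℕ.s≤s⁻¹ (Finₚ.toℕ<n y)) (λ e → y≢-1 (Finₚ.toℕ-injective (trans e (sym toℕ-⊖one))))))

    module _ {i j : Fin n} (i≢j : i ≢ j) (x : Fin n → ℚ) (kirchhoff : ∀ v → netCurrent G x v ≡ source i j v)
             (i-after-j : σ ⟨$⟩ʳ i ≡ (σ ⟨$⟩ʳ j) ⊕ one) where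

      N β : ℚ
      N = fromℕ (suc (suc m))
      β = 1/suc (suc (suc m))

      c : Fin n
      c = σ ⟨$⟩ʳ j

      -- ψ drops by β along every step P → P ⊕ one of the cycle except the step from c, where it rises by N * β.
      ψ : Fin n → ℚ
      ψ P = fromℕ (toℕ (c ⊕ ⊖ P)) * β

      ψ-step : ∀ P → P ≢ c → ψ P - ψ (P ⊕ one) ≡ β
      ψ-step P P≢c = begin
        fromℕ (toℕ (c ⊕ ⊖ P)) * β - fromℕ (toℕ D) * β        ≡⟨ cong (λ z → fromℕ (toℕ z) * β - fromℕ (toℕ D) * β) D+1≡ ⟩
        fromℕ (toℕ (D ⊕ one)) * β - fromℕ (toℕ D) * β        ≡⟨ cong (λ z → fromℕ z * β - fromℕ (toℕ D) * β) (toℕ-⊕one D D≢-1) ⟩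
        (1ℚ + fromℕ (toℕ D)) * β - fromℕ (toℕ D) * β         ≡⟨ solve 2 (λ t b → (con 1ℚ :+ t) :* b :- t :* b := b) refl (fromℕ (toℕ D)) β ⟩
        β                                                     ∎
        where
        open ≡-Reasoning
        D : Fin n
        D = c ⊕ ⊖ (P ⊕ one)
        D+1≡ : c ⊕ ⊖ P ≡ D ⊕ one
        D+1≡ = sym (trans (cong (λ z → c ⊕ z ⊕ one) (sym (⁻¹-∙-comm P one)))
                   (trans (⊕-assoc c (⊖ P ⊕ ⊖ one) one) (cong (c ⊕_) (⊖-⊕-cancel (⊖ P) one))))
        D≢-1 : D ≢ ⊖ one
        D≢-1 e = P≢c (sym (begin
          c                               ≡⟨ sym (⊖-⊕-cancel c (P ⊕ one)) ⟩
          D ⊕ (P ⊕ one)                   ≡⟨ cong (_⊕ (P ⊕ one)) e ⟩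
          ⊖ one ⊕ (P ⊕ one)               ≡⟨ ⊕-comm (⊖ one) (P ⊕ one) ⟩
          P ⊕ one ⊕ ⊖ one                 ≡⟨ ⊕-⊖-cancel P one ⟩
          P                               ∎))

      ψ-c : ψ c ≡ 0ℚ
      ψ-c = trans (cong (λ z → fromℕ (toℕ z) * β) (⊕-inverseʳ c)) (*-zeroˡ β)

      ψ-c+1 : ψ (c ⊕ one) ≡ N * β
      ψ-c+1 = cong (λ z → fromℕ z * β) (trans (cong toℕ c-⊖[c+1]) toℕ-⊖one)
        where
        c-⊖[c+1] : c ⊕ ⊖ (c ⊕ one) ≡ ⊖ one
        c-⊖[c+1] = trans (cong (c ⊕_) (sym (⁻¹-∙-comm c one)))
          (trans (sym (⊕-assoc c (⊖ c) (⊖ one))) (trans (cong (_⊕ ⊖ one) (⊕-inverseʳ c)) (⊕-identityˡ (⊖ one))))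

      d : ℚ
      d = N * β

      sq-d+Nβ²≡d : sq d + N * sq β ≡ d
      sq-d+Nβ²≡d = begin
        (N * β) * (N * β) + N * (β * β)   ≡⟨ solve 2 (λ N b → (N :* b) :* (N :* b) :+ N :* (b :* b) := (N :* b) :* ((con 1ℚ :+ N) :* b)) refl N β ⟩
        (N * β) * ((1ℚ + N) * β)          ≡⟨ cong ((N * β) *_) (fromℕ-suc*1/suc (suc (suc m))) ⟩
        (N * β) * 1ℚ                      ≡⟨ *-identityʳ d ⟩
        d                                 ∎
        where open ≡-Reasoning

      energy-ψ : sumFin n (λ P → sq (ψ P - ψ (P ⊕ one)) + sq (ψ P - ψ (P ⊕ ⊖ one))) ≡ d + d
      energy-ψ = begin
        sumFin n (λ P → sq (ψ P - ψ (P ⊕ one)) + sq (ψ P - ψ (P ⊕ ⊖ one)))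
          ≡⟨ sum-+ (λ P → sq (ψ P - ψ (P ⊕ one))) (λ P → sq (ψ P - ψ (P ⊕ ⊖ one))) ⟩
        sumFin n (λ P → sq (ψ P - ψ (P ⊕ one))) + sumFin n (λ P → sq (ψ P - ψ (P ⊕ ⊖ one)))
          ≡⟨ cong₂ _+_ (sum-spike (suc (suc m)) _ c forward-c (λ P P≢c → cong sq (ψ-step P P≢c)))
                       (sum-spike (suc (suc m)) _ (c ⊕ one) backward-c+1 backward) ⟩
        (sq d + N * sq β) + (sq d + N * sq β)   ≡⟨ cong₂ _+_ sq-d+Nβ²≡d sq-d+Nβ²≡d ⟩
        d + d ∎
        where
        open ≡-Reasoning
        forward-c : sq (ψ c - ψ (c ⊕ one)) ≡ sq d
        forward-c = trans (cong₂ (λ a b → sq (a - b)) ψ-c ψ-c+1) (trans (cong sq (+-identityˡ (- d))) (sq-neg d))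
        backward-c+1 : sq (ψ (c ⊕ one) - ψ (c ⊕ one ⊕ ⊖ one)) ≡ sq d
        backward-c+1 = trans (cong₂ (λ a b → sq (a - b)) ψ-c+1 (trans (cong ψ (⊕-⊖-cancel c one)) ψ-c)) (cong sq (+-identityʳ d))
        backward : ∀ P → P ≢ c ⊕ one → sq (ψ P - ψ (P ⊕ ⊖ one)) ≡ sq β
        backward P P≢c+1 = begin
          sq (ψ P - ψ P-1)                        ≡⟨ cong (λ z → sq (ψ z - ψ P-1)) (sym (⊖-⊕-cancel P one)) ⟩
          sq (ψ (P-1 ⊕ one) - ψ P-1)              ≡⟨ solve 2 (λ a b → (b :- a) :* (b :- a) := (a :- b) :* (a :- b)) refl (ψ P-1) (ψ (P-1 ⊕ one)) ⟩
          sq (ψ P-1 - ψ (P-1 ⊕ one))              ≡⟨ cong sq (ψ-step P-1 (P≢c+1 ∘ ≡⊖⇒≡⊕ one)) ⟩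
          sq β                                    ∎
          where
          P-1 : Fin n
          P-1 = P ⊕ ⊖ one

      cycle-edge-resistance-≥ : N ≤ fromℕ n * (x i - x j)
      cycle-edge-resistance-≥ = begin
        N                       ≡⟨ sym n·d≡N ⟩
        fromℕ n * d             ≤⟨ *-monoˡ-≤-0≤ (0≤fromℕ n) (x+x≤y+y⇒x≤y (+-cancelʳ-≤ (d + d) dirichlet-ψ)) ⟩
        fromℕ n * (x i - x j)   ∎
        where
        open ≤-Reasoning
        φ : Fin n → ℚ
        φ v = ψ (σ ⟨$⟩ʳ v)
        φi-φj≡d : φ i - φ j ≡ d
        φi-φj≡d = trans (cong₂ _-_ (trans (cong ψ i-after-j) ψ-c+1) ψ-c) (+-identityʳ d)
        energy-φ : edgeSum (λ v u → grad φ v u * grad φ v u) ≡ d + d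
        energy-φ = trans (edgeSum-σ (λ P Q → sq (ψ P - ψ Q))) energy-ψ
        dirichlet-ψ : (d + d) + (d + d) ≤ ((x i - x j) + (x i - x j)) + (d + d)
        dirichlet-ψ = subst₂ _≤_ (cong (λ z → (z + z) + (z + z)) φi-φj≡d) (cong (((x i - x j) + (x i - x j)) +_) energy-φ)
                        (dirichlet i≢j x kirchhoff φ)
        n·d≡N : fromℕ n * d ≡ N
        n·d≡N = trans (cong (fromℕ n *_) (*-comm N β)) (trans (sym (*-assoc (fromℕ n) β N))
                  (trans (cong (_* N) (fromℕ-suc*1/suc (suc (suc m)))) (*-identityˡ N)))

    edge-resistance-≥ : ∀ {i j} → G i j ≡ true → ∀ (x : Fin n → ℚ) → (∀ v → netCurrent G x v ≡ source i j v) →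
      fromℕ (suc (suc m)) ≤ fromℕ n * (x i - x j)
    edge-resistance-≥ {i} {j} i~j x kirchhoff with cycle⇒step (σ ⟨$⟩ʳ i) (σ ⟨$⟩ʳ j) (trans (sym (σ-iso i j)) i~j)
    ... | inj₂ i-after-j = cycle-edge-resistance-≥ i≢j x kirchhoff i-after-j
      where i≢j = circAdj⇒≢ l i~j
    ... | inj₁ j-after-i = subst (λ z → fromℕ (suc (suc m)) ≤ fromℕ n * z)
        (solve 2 (λ a b → (:- a) :- (:- b) := b :- a) refl (x j) (x i))
        (cycle-edge-resistance-≥ (i≢j ∘ sym) (λ v → - x v) reversed j-after-i)
      where
      i≢j = circAdj⇒≢ l i~j
      reversed : ∀ v → netCurrent G (λ v → - x v) v ≡ source j i v
      reversed v = trans (netCurrent-neg x v) (trans (cong -_ (kirchhoff v)) (source-swap i≢j v))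

  injective⇒surjective : ∀ {n} (g : Fin n → Fin n) → Injective _≡_ _≡_ g → ∀ p → ∃ λ v → g v ≡ p
  injective⇒surjective {suc n} g g-inj p with Finₚ.any? (λ v → g v Fin.≟ p)
  ... | yes hit = hit
  ... | no miss = ⊥-elim (ℕₚ.<-irrefl refl (Finₚ.injective⇒≤ {f = avoid} avoid-injective))
    where
    avoid : Fin (suc n) → Fin n
    avoid v = Fin.punchOut {i = p} {j = g v} (λ e → miss (v , sym e))
    avoid-injective : ∀ {a b} → avoid a ≡ avoid b → a ≡ b
    avoid-injective {a} {b} e = g-inj (Finₚ.punchOut-injective (λ e′ → miss (a , sym e′)) (λ e′ → miss (b , sym e′)) e)

  Bool-≡ : ∀ {b c : Bool} → (b ≡ true → c ≡ true) → (c ≡ true → b ≡ true) → b ≡ c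
  Bool-≡ {true} {true} _ _ = refl
  Bool-≡ {true} {false} b⇒c _ = sym (b⇒c refl)
  Bool-≡ {false} {true} _ c⇒b = c⇒b refl
  Bool-≡ {false} {false} _ _ = refl

  module CirculantStructure (m : ℕ) (l : List ℕ) (connected : Connected (Circulant (suc (suc (suc m))) l)) where
    open CirculantGraph m l

    module _ {k} (k∈l : k ∈ l) (2K≢0 : k mod n ⊕ k mod n ≢ zero) where

      K : Fin n
      K = k mod n

      K≢0 : K ≢ zero
      K≢0 = k⊕k≢0⇒k≢0 K 2K≢0

      private
        0≤edge : ∀ v u → 0ℚ ≤ guard (G v u) 1ℚ
        0≤edge v u = 0≤guard (G v u) (nonNegative⁻¹ 1ℚ)

        edge : ∀ {v u} → G v u ≡ true → guard (G v u) 1ℚ ≡ 1ℚ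
        edge = cong (λ b → guard b 1ℚ)

      degree-≥2 : ∀ v → 1ℚ + 1ℚ ≤ degree v
      degree-≥2 v = subst (_≤ degree v) (cong₂ _+_ (edge (adjacent-⊕ k∈l K≢0 v)) (edge (adjacent-⊖ k∈l K≢0 v)))
                      (two-terms≤sum (0≤edge v) (2K≢0 ∘ ⊕≡⊕⊖⇒k⊕k≡0 v K))

      degree-≥3 : ∀ {t} → t ∈ l → t mod n ≢ zero → t mod n ≢ K → t mod n ≢ ⊖ K → ∀ v → 1ℚ + (1ℚ + 1ℚ) ≤ degree v
      degree-≥3 {t} t∈l T≢0 T≢K T≢-K v =
        subst (_≤ degree v) (cong₂ _+_ (edge (adjacent-⊕ k∈l K≢0 v)) (cong₂ _+_ (edge (adjacent-⊖ k∈l K≢0 v)) (edge (adjacent-⊕ t∈l T≢0 v))))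
          (three-terms≤sum (0≤edge v) (2K≢0 ∘ ⊕≡⊕⊖⇒k⊕k≡0 v K) (T≢K ∘ sym ∘ ⊕-cancelˡ v K (t mod n)) (T≢-K ∘ sym ∘ ⊕-cancelˡ v (⊖ K) (t mod n)))

      module _ (only-±K : ∀ {t} → t ∈ l → t mod n ≡ zero ⊎ t mod n ≡ K ⊎ t mod n ≡ ⊖ K) where

        adjacent⇒±K : ∀ v u → G v u ≡ true → u ≡ v ⊕ K ⊎ v ≡ u ⊕ K
        adjacent⇒±K v u v~u with adjacent⇒jump l v u v~u
        ... | t , t∈l , T≢0 , shifted with only-±K t∈l | shifted
        ...   | inj₁ T≡0 | _ = ⊥-elim (T≢0 T≡0)
        ...   | inj₂ (inj₁ T≡K) | inj₁ v+T≡u = inj₁ (sym (trans (cong (v ⊕_) (sym T≡K)) v+T≡u))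
        ...   | inj₂ (inj₁ T≡K) | inj₂ u+T≡v = inj₂ (sym (trans (cong (u ⊕_) (sym T≡K)) u+T≡v))
        ...   | inj₂ (inj₂ T≡-K) | inj₁ v-K≡u = inj₂ (≡⊖⇒≡⊕ K (trans (cong (v ⊕_) (sym T≡-K)) v-K≡u))
        ...   | inj₂ (inj₂ T≡-K) | inj₂ u-K≡v = inj₁ (≡⊖⇒≡⊕ K (trans (cong (u ⊕_) (sym T≡-K)) u-K≡v))

        ±K⇒adjacent : ∀ v u → u ≡ v ⊕ K ⊎ v ≡ u ⊕ K → G v u ≡ true
        ±K⇒adjacent v u (inj₁ e) = jump⇒adjacent l v u k k∈l (K≢0 , inj₁ (sym e))
        ±K⇒adjacent v u (inj₂ e) = jump⇒adjacent l v u k k∈l (K≢0 , inj₂ (sym e))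

        multiple : ℕ → Fin n
        multiple a = (a ℕ.* k) mod n

        multiple-suc : ∀ a → multiple (suc a) ≡ multiple a ⊕ K
        multiple-suc a = trans (mod-+ k (a ℕ.* k)) (⊕-comm K (multiple a))

        multiple-% : ∀ a → multiple (a % n) ≡ multiple a
        multiple-% a = mod-cong {(a % n) ℕ.* k} {a ℕ.* k} (trans (%-distribˡ-* (a % n) k n)
          (trans (cong (λ z → (z ℕ.* (k % n)) % n) (m%n%n≡m%n a n)) (sym (%-distribˡ-* a k n))))

        multiple-pred : ∀ a → multiple (a ℕ.+ suc (suc m)) ⊕ K ≡ multiple a
        multiple-pred a = begin
          multiple (a ℕ.+ suc (suc m)) ⊕ K     ≡⟨ sym (multiple-suc (a ℕ.+ suc (suc m))) ⟩
          multiple (suc (a ℕ.+ suc (suc m)))   ≡⟨ cong multiple (sym (ℕₚ.+-suc a (suc (suc m)))) ⟩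
          multiple (a ℕ.+ n)                   ≡⟨ sym (multiple-% (a ℕ.+ n)) ⟩
          multiple ((a ℕ.+ n) % n)             ≡⟨ cong multiple ([m+n]%n≡m%n a n) ⟩
          multiple (a % n)                     ≡⟨ multiple-% a ⟩
          multiple a                           ∎
          where open ≡-Reasoning

        every-vertex-is-a-multiple : ∀ w → ∃ λ a → multiple a ≡ w
        every-vertex-is-a-multiple w = walk (connected zero w) (0 , refl)
          where
          walk : ∀ {v w} → Star (Edge G) v w → (∃ λ a → multiple a ≡ v) → ∃ λ a → multiple a ≡ w
          walk ε found = found
          walk {v} (_◅_ {j = u} v~u u⇝w) (a , aK≡v) with adjacent⇒±K v u v~u
          ... | inj₁ u≡v+K = walk u⇝w (suc a , trans (multiple-suc a) (trans (cong (_⊕ K) aK≡v) (sym u≡v+K)))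
          ... | inj₂ v≡u+K = walk u⇝w (a ℕ.+ suc (suc m) , ⊕-cancelʳ K _ u (trans (multiple-pred a) (trans aK≡v v≡u+K)))

        position : Fin n → Fin n
        position w = proj₁ (every-vertex-is-a-multiple w) mod n

        vertex : Fin n → Fin n
        vertex p = multiple (toℕ p)

        vertex∘position : ∀ w → vertex (position w) ≡ w
        vertex∘position w = trans (cong multiple (toℕ-mod a)) (trans (multiple-% a) (proj₂ (every-vertex-is-a-multiple w)))
          where a = proj₁ (every-vertex-is-a-multiple w)

        position-injective : Injective _≡_ _≡_ position
        position-injective {a} {b} e = trans (sym (vertex∘position a)) (trans (cong vertex e) (vertex∘position b))

        position∘vertex : ∀ p → position (vertex p) ≡ p
        position∘vertex p with injective⇒surjective position position-injective p
        ... | w , refl = cong position (vertex∘position w)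

        vertex-+1 : ∀ p → vertex (p ⊕ one) ≡ vertex p ⊕ K
        vertex-+1 p = trans (cong multiple (toℕ-⊕-mod p 1)) (trans (multiple-% (toℕ p ℕ.+ 1))
                        (trans (cong multiple (ℕₚ.+-comm (toℕ p) 1)) (multiple-suc (toℕ p))))

        isomorphic-to-cycle : Isomorphic G (cycleGraph n)
        isomorphic-to-cycle = permutation position vertex position∘vertex vertex∘position , λ v u → Bool-≡ (to v u) (from v u)
          where
          vertex-injective : Injective _≡_ _≡_ vertex
          vertex-injective {a} {b} e = trans (sym (position∘vertex a)) (trans (cong position e) (position∘vertex b))
          to : ∀ v u → G v u ≡ true → cycleGraph n (position v) (position u) ≡ true
          to v u v~u with adjacent⇒±K v u v~u
          ... | inj₁ e = step⇒cycle (position v) (position u) (inj₁ (vertex-injective (trans (vertex∘position u)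
                           (trans e (trans (cong (_⊕ K) (sym (vertex∘position v))) (sym (vertex-+1 (position v))))))))
          ... | inj₂ e = step⇒cycle (position v) (position u) (inj₂ (vertex-injective (trans (vertex∘position v)
                           (trans e (trans (cong (_⊕ K) (sym (vertex∘position u))) (sym (vertex-+1 (position u))))))))
          from : ∀ v u → cycleGraph n (position v) (position u) ≡ true → G v u ≡ true
          from v u adj with cycle⇒step (position v) (position u) adj
          ... | inj₁ e = ±K⇒adjacent v u (inj₁ (trans (sym (vertex∘position u))
                           (trans (cong vertex e) (trans (vertex-+1 (position v)) (cong (_⊕ K) (vertex∘position v))))))
          ... | inj₂ e = ±K⇒adjacent v u (inj₂ (trans (sym (vertex∘position v))
                           (trans (cong vertex e) (trans (vertex-+1 (position u)) (cong (_⊕ K) (vertex∘position u))))))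

  _<ᵇ_ : ∀ {n} → Fin n → Fin n → Bool
  i <ᵇ j = ⌊ toℕ i ℕ.<? toℕ j ⌋

  <ᵇ⇒< : ∀ {n} {i j : Fin n} → (i <ᵇ j) ≡ true → toℕ i ℕ.< toℕ j
  <ᵇ⇒< {i = i} {j} h with toℕ i ℕ.<? toℕ j | h
  ... | yes i<j | _ = i<j

  <⇒<ᵇ : ∀ {n} {i j : Fin n} → toℕ i ℕ.< toℕ j → (i <ᵇ j) ≡ true
  <⇒<ᵇ {i = i} {j} i<j = trans (isYes≗does (toℕ i ℕ.<? toℕ j)) (dec-true (toℕ i ℕ.<? toℕ j) i<j)

  guard-∧ : ∀ b c q → guard (b ∧ c) q ≡ guard b (guard c q)
  guard-∧ true c q = refl
  guard-∧ false c q = refl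

  module _ {n : ℕ} where

    doubleSum : (Fin n → Fin n → ℚ) → ℚ
    doubleSum H = sumFin n (λ i → sumFin n (H i))

    doubleSum-cong : ∀ {F H} → (∀ i j → F i j ≡ H i j) → doubleSum F ≡ doubleSum H
    doubleSum-cong F≗H = sum-cong (λ i → sum-cong (F≗H i))

    doubleSum-+ : ∀ F H → doubleSum (λ i j → F i j + H i j) ≡ doubleSum F + doubleSum H
    doubleSum-+ F H = trans (sum-cong (λ i → sum-+ (F i) (H i))) (sum-+ (λ i → sumFin n (F i)) (λ i → sumFin n (H i)))

    doubleSum-*ˡ : ∀ c F → doubleSum (λ i j → c * F i j) ≡ c * doubleSum F
    doubleSum-*ˡ c F = trans (sum-cong (λ i → sum-*ˡ c (F i))) (sum-*ˡ c (λ i → sumFin n (F i)))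

    doubleSum-mono-≤ : ∀ {F H} → (∀ i j → F i j ≤ H i j) → doubleSum F ≤ doubleSum H
    doubleSum-mono-≤ F≤H = sum-mono-≤ (λ i → sum-mono-≤ (F≤H i))

    doubleSum-≤-≡⇒≡ : ∀ {F H} → (∀ i j → F i j ≤ H i j) → doubleSum F ≡ doubleSum H → ∀ i j → F i j ≡ H i j
    doubleSum-≤-≡⇒≡ F≤H eq i = sum-≤-≡⇒≡ (F≤H i) (sum-≤-≡⇒≡ (λ i → sum-mono-≤ (F≤H i)) eq i)

    upper+upper≡doubleSum : ∀ H → (∀ i j → H i j ≡ H j i) → (∀ i → H i i ≡ 0ℚ) →
      doubleSum (λ i j → guard (i <ᵇ j) (H i j)) + doubleSum (λ i j → guard (i <ᵇ j) (H i j)) ≡ doubleSum H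
    upper+upper≡doubleSum H H-sym H-diag = sym (begin
      doubleSum H                                   ≡⟨ doubleSum-cong split ⟩
      doubleSum (λ i j → upper i j + guard (j <ᵇ i) (H i j))     ≡⟨ doubleSum-+ upper (λ i j → guard (j <ᵇ i) (H i j)) ⟩
      doubleSum upper + doubleSum (λ i j → guard (j <ᵇ i) (H i j)) ≡⟨ cong (doubleSum upper +_) lower≡upper ⟩
      doubleSum upper + doubleSum upper             ∎)
      where
      open ≡-Reasoning
      upper : Fin n → Fin n → ℚ
      upper i j = guard (i <ᵇ j) (H i j)
      split : ∀ i j → H i j ≡ upper i j + guard (j <ᵇ i) (H i j)
      split i j with toℕ i ℕ.<? toℕ j | toℕ j ℕ.<? toℕ i
      ... | yes i<j | yes j<i = ⊥-elim (ℕₚ.<-asym i<j j<i)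
      ... | yes _ | no _ = sym (+-identityʳ (H i j))
      ... | no _ | yes _ = sym (+-identityˡ (H i j))
      ... | no i≮j | no j≮i with Finₚ.toℕ-injective (ℕₚ.≤-antisym (ℕₚ.≮⇒≥ j≮i) (ℕₚ.≮⇒≥ i≮j))
      ...   | refl = H-diag i
      lower≡upper : doubleSum (λ i j → guard (j <ᵇ i) (H i j)) ≡ doubleSum upper
      lower≡upper = trans (sum-comm n n (λ i j → guard (j <ᵇ i) (H i j)))
                          (doubleSum-cong (λ j i → cong (guard (j <ᵇ i)) (H-sym i j)))

  pairCount : ℕ → ℚ
  pairCount n = doubleSum {n} (λ i j → guard (i <ᵇ j) 1ℚ)

  pairCount+pairCount : ∀ n′ → pairCount (suc n′) + pairCount (suc n′) ≡ fromℕ (suc n′) * fromℕ n′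
  pairCount+pairCount n′ = begin
    pairCount n + pairCount n                     ≡⟨ cong₂ _+_ upper≡ upper≡ ⟩
    doubleSum upper + doubleSum upper             ≡⟨ upper+upper≡doubleSum distinct (λ i j → cong (λ b → guard (not b) 1ℚ) (==F-sym i j))
                                                       (λ i → cong (λ b → guard (not b) 1ℚ) (==F-refl i)) ⟩
    doubleSum distinct                            ≡⟨ sum-cong (λ i → trans (sum-spike n′ (distinct i) i (cong (λ b → guard (not b) 1ℚ) (==F-refl i))
                                                       (λ u u≢i → cong (λ b → guard (not b) 1ℚ) (==F-≢ (u≢i ∘ sym)))) (trans (+-identityˡ _) (*-identityʳ (fromℕ n′)))) ⟩
    sumFin n (λ _ → fromℕ n′)                     ≡⟨ sum-const n (fromℕ n′) ⟩
    fromℕ n * fromℕ n′                            ∎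
    where
    open ≡-Reasoning
    n = suc n′
    distinct : Fin n → Fin n → ℚ
    distinct i j = guard (not (i ==F j)) 1ℚ
    upper : Fin n → Fin n → ℚ
    upper i j = guard (i <ᵇ j) (distinct i j)
    ==F-sym : ∀ (i j : Fin n) → (i ==F j) ≡ (j ==F i)
    ==F-sym i j with i Fin.≟ j
    ... | yes refl = refl
    ... | no i≢j = trans (==F-≢ i≢j) (sym (==F-≢ (i≢j ∘ sym)))
    upper≡ : pairCount n ≡ doubleSum upper
    upper≡ = doubleSum-cong λ i j → lt i j
      where
      lt : ∀ i j → guard (i <ᵇ j) 1ℚ ≡ upper i j
      lt i j with toℕ i ℕ.<? toℕ j
      ... | yes i<j = cong (λ b → guard (not b) 1ℚ) (sym (==F-≢ (λ e → ℕₚ.<-irrefl (cong toℕ e) i<j)))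
      ... | no _ = refl

  module CyclicityBounds {n : ℕ} (G : Graph n) (G-sym : ∀ i j → G i j ≡ G j i) (G-irrefl : ∀ i → G i i ≡ false)
                         (Ω : Fin n → Fin n → ℚ) where

    open Network G G-sym using (degree)

    upperEdge : Fin n → Fin n → ℚ
    upperEdge i j = guard (i <ᵇ j ∧ G i j) 1ℚ

    edgeCount : ℚ
    edgeCount = doubleSum upperEdge

    edgeCount+edgeCount : edgeCount + edgeCount ≡ sumFin n degree
    edgeCount+edgeCount = trans (cong₂ _+_ nested nested)
      (upper+upper≡doubleSum (λ i j → guard (G i j) 1ℚ) (λ i j → cong (λ b → guard b 1ℚ) (G-sym i j))
                                       (λ i → cong (λ b → guard b 1ℚ) (G-irrefl i)))
      where
      nested : edgeCount ≡ doubleSum (λ i j → guard (i <ᵇ j) (guard (G i j) 1ℚ))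
      nested = doubleSum-cong (λ i j → guard-∧ (i <ᵇ j) (G i j) 1ℚ)

    term : Fin n → Fin n → ℚ
    term i j = guard (i <ᵇ j ∧ G i j) (inv (Ω i j) - 1ℚ)

    cyclicity-≥ : ∀ a → (∀ i j → G i j ≡ true → a ≤ inv (Ω i j) - 1ℚ) → a * edgeCount ≤ cyclicity G Ω
    cyclicity-≥ a a≤ = ≤-trans (≤-reflexive (sym (doubleSum-*ˡ a upperEdge))) (doubleSum-mono-≤ termwise)
      where
      termwise : ∀ i j → a * upperEdge i j ≤ term i j
      termwise i j with i <ᵇ j ∧ G i j in e
      ... | true = ≤-trans (≤-reflexive (*-identityʳ a)) (a≤ i j (proj₂ (∧≡true⇒ e)))
      ... | false = ≤-reflexive (*-zeroʳ a)

    cyclicity≡ : ∀ a → (∀ i j → G i j ≡ true → inv (Ω i j) - 1ℚ ≡ a) → cyclicity G Ω ≡ a * edgeCount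
    cyclicity≡ a ≡a = trans (doubleSum-cong termwise) (doubleSum-*ˡ a upperEdge)
      where
      termwise : ∀ i j → term i j ≡ a * upperEdge i j
      termwise i j with i <ᵇ j ∧ G i j in e
      ... | true = trans (≡a i j (proj₂ (∧≡true⇒ e))) (sym (*-identityʳ a))
      ... | false = sym (*-zeroʳ a)

    private
      upperPair : Fin n → Fin n → ℚ
      upperPair i j = guard (i <ᵇ j) 1ℚ

      term≤ : ∀ b → 0ℚ ≤ b → (∀ i j → G i j ≡ true → inv (Ω i j) - 1ℚ ≤ b) → ∀ i j → term i j ≤ b * upperPair i j
      term≤ b 0≤b ≤b i j with i <ᵇ j in i<j | G i j in i~j
      ... | true | true = ≤-trans (≤b i j i~j) (≤-reflexive (sym (*-identityʳ b)))
      ... | true | false = ≤-trans 0≤b (≤-reflexive (sym (*-identityʳ b)))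
      ... | false | _ = ≤-reflexive (sym (*-zeroʳ b))

    cyclicity-≤ : ∀ b → 0ℚ ≤ b → (∀ i j → G i j ≡ true → inv (Ω i j) - 1ℚ ≤ b) → cyclicity G Ω ≤ b * pairCount n
    cyclicity-≤ b 0≤b ≤b = ≤-trans (doubleSum-mono-≤ (term≤ b 0≤b ≤b)) (≤-reflexive (doubleSum-*ˡ b upperPair))

    all-pairs-adjacent⇒complete : (∀ i j → (i <ᵇ j) ≡ true → G i j ≡ true) → Isomorphic G (completeGraph n)
    all-pairs-adjacent⇒complete adjacent = Permutation.id , λ i j → adjacency i j
      where
      adjacency : ∀ i j → G i j ≡ not (i ==F j)
      adjacency i j with ℕₚ.<-cmp (toℕ i) (toℕ j)
      ... | tri< i<j _ _ = trans (adjacent i j (<⇒<ᵇ i<j)) (cong not (sym (==F-≢ (λ e → ℕₚ.<-irrefl (cong toℕ e) i<j))))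
      ... | tri> _ _ j<i = trans (G-sym i j) (trans (adjacent j i (<⇒<ᵇ j<i)) (cong not (sym (==F-≢ (λ e → ℕₚ.<-irrefl (cong toℕ (sym e)) j<i)))))
      ... | tri≈ _ i≡j _ with Finₚ.toℕ-injective i≡j
      ...   | refl = trans (G-irrefl i) (cong not (sym (==F-refl i)))

    all-pairs-adjacent⇒edgeCount≡pairCount : (∀ i j → (i <ᵇ j) ≡ true → G i j ≡ true) → edgeCount ≡ pairCount n
    all-pairs-adjacent⇒edgeCount≡pairCount adjacent = doubleSum-cong termwise
      where
      termwise : ∀ i j → upperEdge i j ≡ upperPair i j
      termwise i j with i <ᵇ j in i<j
      ... | true = cong (λ b → guard b 1ℚ) (adjacent i j i<j)
      ... | false = refl

    cyclicity≡⇒complete : ∀ b → 0ℚ < b → (∀ i j → G i j ≡ true → inv (Ω i j) - 1ℚ ≤ b) →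
      cyclicity G Ω ≡ b * pairCount n → Isomorphic G (completeGraph n)
    cyclicity≡⇒complete b 0<b ≤b eq = all-pairs-adjacent⇒complete adjacent
      where
      termwise : ∀ i j → term i j ≡ b * upperPair i j
      termwise = doubleSum-≤-≡⇒≡ (term≤ b (<⇒≤ 0<b) ≤b) (trans eq (sym (doubleSum-*ˡ b upperPair)))
      adjacent : ∀ i j → (i <ᵇ j) ≡ true → G i j ≡ true
      adjacent i j i<j with G i j in i~j
      ... | true = refl
      ... | false = ⊥-elim (<⇒≢ 0<b (begin
        0ℚ                 ≡⟨ sym (cong₂ (λ c d → guard (c ∧ d) (inv (Ω i j) - 1ℚ)) i<j i~j) ⟩
        term i j           ≡⟨ termwise i j ⟩
        b * upperPair i j  ≡⟨ cong (λ c → b * guard c 1ℚ) i<j ⟩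
        b * 1ℚ             ≡⟨ *-identityʳ b ⟩
        b                  ∎))
        where open ≡-Reasoning

  complete-adjacency : ∀ {n} {G : Graph n} → (∀ i → G i i ≡ false) → Isomorphic G (completeGraph n) → ∀ i j → G i j ≡ not (i ==F j)
  complete-adjacency {G = G} G-irrefl (σ , σ-iso) i j with i Fin.≟ j
  ... | yes refl = trans (G-irrefl i) (cong not (sym (==F-refl i)))
  ... | no i≢j = trans (σ-iso i j) (cong not (trans (==F-≢ (λ e → i≢j (trans (sym (Permutation.inverseˡ σ)) (trans (cong (σ Permutation.⟨$⟩ˡ_) e) (Permutation.inverseˡ σ))))) (sym (==F-≢ i≢j))))

  module CompleteNetwork {n : ℕ} (G : Graph n) (complete : ∀ i j → G i j ≡ not (i ==F j)) where

    netCurrent-complete : ∀ (x : Fin n → ℚ) v → netCurrent G x v ≡ fromℕ n * x v - sumFin n x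
    netCurrent-complete x v = begin
      sumFin n (λ u → guard (G v u) (x v - x u))     ≡⟨ sum-cong term ⟩
      sumFin n (λ u → x v + - x u)                   ≡⟨ sum-+ (λ _ → x v) (λ u → - x u) ⟩
      sumFin n (λ _ → x v) + sumFin n (λ u → - x u)  ≡⟨ cong₂ _+_ (sum-const n (x v)) (sum-neg x) ⟩
      fromℕ n * x v - sumFin n x                     ∎
      where
      open ≡-Reasoning
      term : ∀ u → guard (G v u) (x v - x u) ≡ x v + - x u
      term u with v Fin.≟ u
      ... | yes refl = trans (cong (λ b → guard b (x v - x v)) (trans (complete v v) (cong not (==F-refl v)))) (sym (+-inverseʳ (x v)))
      ... | no v≢u = cong (λ b → guard b (x v - x u)) (trans (complete v u) (cong not (==F-≢ v≢u)))

    resistance-complete : ∀ {i j} → i ≢ j → ∀ (x : Fin n → ℚ) → (∀ v → netCurrent G x v ≡ source i j v) →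
      fromℕ n * (x i - x j) ≡ 1ℚ + 1ℚ
    resistance-complete {i} {j} i≢j x kirchhoff = begin
      fromℕ n * (x i - x j)                                       ≡⟨ solve 4 (λ N a b S → N :* (a :- b) := (N :* a :- S) :- (N :* b :- S))
                                                                       refl (fromℕ n) (x i) (x j) (sumFin n x) ⟩
      (fromℕ n * x i - sumFin n x) - (fromℕ n * x j - sumFin n x) ≡⟨ sym (cong₂ _-_ (netCurrent-complete x i) (netCurrent-complete x j)) ⟩
      netCurrent G x i - netCurrent G x j                         ≡⟨ cong₂ _-_ (kirchhoff i) (kirchhoff j) ⟩
      source i j i - source i j j                                 ≡⟨ cong₂ _-_ (source-at-source {i = i} {j = j}) (source-at-sink i≢j) ⟩
      1ℚ + 1ℚ                                                     ∎
      where open ≡-Reasoning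

  module CirculantCyclicity (m : ℕ) (l : List ℕ) (connected : Connected (Circulant (suc (suc (suc m))) l))
    (Ω : Fin (suc (suc (suc m))) → Fin (suc (suc (suc m))) → ℚ)
    (effective : ∀ i j → Edge (Circulant (suc (suc (suc m))) l) i j → IsEffRes (Circulant (suc (suc (suc m))) l) i j (Ω i j)) where

    open CirculantGraph m l
    open EdgeResistance m l connected using (edge-resistance-≤; jump-of-order>2)
    open CirculantStructure m l connected
    open CyclicityBounds G (circAdj-sym l) (circAdj-irrefl l) Ω

    N : ℚ
    N = fromℕ (suc (suc m))

    2≤n·Ω : ∀ {i j} → G i j ≡ true → 1ℚ + 1ℚ ≤ fromℕ n * Ω i j
    2≤n·Ω {i} {j} i~j with effective i j i~j
    ... | x , kirchhoff , Ω≡ = subst (λ r → 1ℚ + 1ℚ ≤ fromℕ n * r) (sym Ω≡) (resistance-≥2/n connected (circAdj⇒≢ l i~j) x kirchhoff)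

    n·Ω≤N : ∀ {i j} → G i j ≡ true → fromℕ n * Ω i j ≤ N
    n·Ω≤N {i} {j} i~j with effective i j i~j
    ... | x , kirchhoff , Ω≡ = subst (λ r → fromℕ n * r ≤ N) (sym Ω≡) (edge-resistance-≤ i~j x kirchhoff)

    0<Ω : ∀ {i j} → G i j ≡ true → 0ℚ < Ω i j
    0<Ω {i} {j} i~j with Ω i j ℚ.≤? 0ℚ
    ... | no Ω≰0 = ≰⇒> Ω≰0
    ... | yes Ω≤0 = ⊥-elim (<-irrefl refl (<-≤-trans (+-mono-< (positive⁻¹ 1ℚ) (positive⁻¹ 1ℚ))
                       (≤-trans (2≤n·Ω i~j) (≤-trans (*-monoˡ-≤-0≤ (0≤fromℕ n) Ω≤0) (≤-reflexive (*-zeroʳ (fromℕ n)))))))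

    1/N ½ [n-2]/2 : ℚ
    1/N = 1/suc (suc m)
    ½ = 1/suc 1
    [n-2]/2 = fromℕ (suc m) * ½

    N·1/N≡1 : N * 1/N ≡ 1ℚ
    N·1/N≡1 = fromℕ-suc*1/suc (suc m)

    n·1/N≡1+1/N : fromℕ n * 1/N ≡ 1ℚ + 1/N
    n·1/N≡1+1/N = trans (*-distribʳ-+ 1/N 1ℚ N) (trans (cong₂ _+_ (*-identityˡ 1/N) N·1/N≡1) (+-comm 1/N 1ℚ))

    n·½-1≡[n-2]/2 : fromℕ n * ½ - 1ℚ ≡ [n-2]/2
    n·½-1≡[n-2]/2 = begin
      fromℕ n * ½ - 1ℚ                              ≡⟨ cong (λ z → z * ½ - 1ℚ) (fromℕ-+ 2 (suc m)) ⟩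
      (fromℕ 2 + fromℕ (suc m)) * ½ - 1ℚ            ≡⟨ solve 2 (λ s h → (con (fromℕ 2) :+ s) :* h :- con 1ℚ := s :* h :+ (con (fromℕ 2) :* h :- con 1ℚ)) refl (fromℕ (suc m)) ½ ⟩
      fromℕ (suc m) * ½ + (fromℕ 2 * ½ - 1ℚ)        ≡⟨ cong (λ z → fromℕ (suc m) * ½ + (z - 1ℚ)) (fromℕ-suc*1/suc 1) ⟩
      fromℕ (suc m) * ½ + (1ℚ - 1ℚ)                 ≡⟨ trans (cong (fromℕ (suc m) * ½ +_) (+-inverseʳ 1ℚ)) (+-identityʳ _) ⟩
      fromℕ (suc m) * ½                             ∎
      where open ≡-Reasoning

    1/N≤term : ∀ {i j} → G i j ≡ true → 1/N ≤ inv (Ω i j) - 1ℚ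
    1/N≤term {i} {j} i~j = begin
      1/N                         ≡⟨ solve 1 (λ x → x := (con 1ℚ :+ x) :- con 1ℚ) refl 1/N ⟩
      (1ℚ + 1/N) - 1ℚ             ≤⟨ +-monoˡ-≤ (- 1ℚ) (≤-inv {c = 1ℚ + 1/N} (0<Ω i~j) (begin
        (1ℚ + 1/N) * Ω i j          ≡⟨ trans (cong (_* Ω i j) (trans (sym n·1/N≡1+1/N) (*-comm (fromℕ n) 1/N))) (*-assoc 1/N (fromℕ n) (Ω i j)) ⟩
        1/N * (fromℕ n * Ω i j)     ≤⟨ *-monoˡ-≤-0≤ (<⇒≤ (0<1/suc (suc m))) (n·Ω≤N i~j) ⟩
        1/N * N                     ≡⟨ trans (*-comm 1/N N) N·1/N≡1 ⟩
        1ℚ                        ∎)) ⟩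
      inv (Ω i j) - 1ℚ          ∎
      where open ≤-Reasoning

    term≤[n-2]/2 : ∀ {i j} → G i j ≡ true → inv (Ω i j) - 1ℚ ≤ [n-2]/2
    term≤[n-2]/2 {i} {j} i~j = ≤-trans (+-monoˡ-≤ (- 1ℚ) (inv-≤ {c = fromℕ n * ½} (0<Ω i~j) (begin
        1ℚ                        ≡⟨ sym (trans (*-comm ½ (fromℕ 2)) (fromℕ-suc*1/suc 1)) ⟩
        ½ * (1ℚ + 1ℚ)             ≤⟨ *-monoˡ-≤-0≤ (<⇒≤ (0<1/suc 1)) (2≤n·Ω i~j) ⟩
        ½ * (fromℕ n * Ω i j)     ≡⟨ trans (sym (*-assoc ½ (fromℕ n) (Ω i j))) (cong (_* Ω i j) (*-comm ½ (fromℕ n))) ⟩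
        (fromℕ n * ½) * Ω i j     ∎))) (≤-reflexive n·½-1≡[n-2]/2)
      where open ≤-Reasoning

    0<[n-2]/2 : 0ℚ < [n-2]/2
    0<[n-2]/2 = subst (_< [n-2]/2) (*-zeroˡ ½) (*-monoˡ-<-pos ½ {{ℚ.positive (0<1/suc 1)}} (0<fromℕ-suc m))

    degrees≥c⇒n·c≤2·edgeCount : ∀ {c} → (∀ v → c ≤ degree v) → fromℕ n * c ≤ edgeCount + edgeCount
    degrees≥c⇒n·c≤2·edgeCount {c} c≤degree = begin
      fromℕ n * c              ≡⟨ sym (sum-const n c) ⟩
      sumFin n (λ _ → c)       ≤⟨ sum-mono-≤ c≤degree ⟩
      sumFin n degree          ≡⟨ sym edgeCount+edgeCount ⟩
      edgeCount + edgeCount    ∎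
      where open ≤-Reasoning

    private
      k : ℕ
      k = proj₁ jump-of-order>2

      k∈l : k ∈ l
      k∈l = proj₁ (proj₂ jump-of-order>2)

      2K≢0 : k mod n ⊕ k mod n ≢ zero
      2K≢0 = proj₂ (proj₂ jump-of-order>2)

    1/N·n≤cyclicity : 1/N * fromℕ n ≤ cyclicity G Ω
    1/N·n≤cyclicity = ≤-trans (*-monoˡ-≤-0≤ (<⇒≤ (0<1/suc (suc m))) n≤edgeCount) (cyclicity-≥ 1/N (λ i j → 1/N≤term))
      where
      n≤edgeCount : fromℕ n ≤ edgeCount
      n≤edgeCount = x+x≤y+y⇒x≤y (≤-trans (≤-reflexive (solve 1 (λ N → N :+ N := N :* (con 1ℚ :+ con 1ℚ)) refl (fromℕ n)))
                                  (degrees≥c⇒n·c≤2·edgeCount (degree-≥2 k∈l 2K≢0)))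

    cyclicity≤[n-2]/2·pairCount : cyclicity G Ω ≤ [n-2]/2 * pairCount n
    cyclicity≤[n-2]/2·pairCount = cyclicity-≤ [n-2]/2 (<⇒≤ 0<[n-2]/2) (λ i j → term≤[n-2]/2)

    cyclicity≡[n-2]/2·pairCount⇒complete : cyclicity G Ω ≡ [n-2]/2 * pairCount n → Isomorphic G (completeGraph n)
    cyclicity≡[n-2]/2·pairCount⇒complete = cyclicity≡⇒complete [n-2]/2 0<[n-2]/2 (λ i j → term≤[n-2]/2)

    complete⇒cyclicity≡[n-2]/2·pairCount : Isomorphic G (completeGraph n) → cyclicity G Ω ≡ [n-2]/2 * pairCount n
    complete⇒cyclicity≡[n-2]/2·pairCount iso = trans (cyclicity≡ [n-2]/2 term≡) (cong ([n-2]/2 *_) (all-pairs-adjacent⇒edgeCount≡pairCount all-pairs))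
      where
      complete : ∀ i j → G i j ≡ not (i ==F j)
      complete = complete-adjacency (circAdj-irrefl l) iso
      open CompleteNetwork G complete
      all-pairs : ∀ i j → (i <ᵇ j) ≡ true → G i j ≡ true
      all-pairs i j i<j = trans (complete i j) (cong not (==F-≢ (λ i≡j → ℕₚ.<-irrefl (cong toℕ i≡j) (<ᵇ⇒< i<j))))
      term≡ : ∀ i j → G i j ≡ true → inv (Ω i j) - 1ℚ ≡ [n-2]/2
      term≡ i j i~j with effective i j i~j
      ... | x , kirchhoff , Ω≡ = trans (cong (_- 1ℚ) (inv-unique {c = fromℕ n * ½} (0<Ω i~j) (begin
        (fromℕ n * ½) * Ω i j      ≡⟨ trans (cong (_* Ω i j) (*-comm (fromℕ n) ½)) (*-assoc ½ (fromℕ n) (Ω i j)) ⟩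
        ½ * (fromℕ n * Ω i j)      ≡⟨ cong (λ r → ½ * (fromℕ n * r)) Ω≡ ⟩
        ½ * (fromℕ n * (x i - x j)) ≡⟨ cong (½ *_) (resistance-complete (circAdj⇒≢ l i~j) x kirchhoff) ⟩
        ½ * (1ℚ + 1ℚ)              ≡⟨ trans (*-comm ½ (fromℕ 2)) (fromℕ-suc*1/suc 1) ⟩
        1ℚ                         ∎))) n·½-1≡[n-2]/2
        where open ≡-Reasoning

    cycle⇒cyclicity≡1/N·n : Isomorphic G (cycleGraph n) → cyclicity G Ω ≡ 1/N * fromℕ n
    cycle⇒cyclicity≡1/N·n (σ , σ-iso) = trans (cyclicity≡ 1/N term≡) (cong (1/N *_) edgeCount≡n)
      where
      open CycleResistance m l σ σ-iso using (edge-resistance-≥; degree≡2)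
      2·edgeCount≡n+n : edgeCount + edgeCount ≡ fromℕ n + fromℕ n
      2·edgeCount≡n+n = trans edgeCount+edgeCount (trans (sum-cong degree≡2)
        (trans (sum-const n (1ℚ + 1ℚ)) (solve 1 (λ N → N :* (con 1ℚ :+ con 1ℚ) := N :+ N) refl (fromℕ n))))
      edgeCount≡n : edgeCount ≡ fromℕ n
      edgeCount≡n = ≤-antisym (x+x≤y+y⇒x≤y (≤-reflexive 2·edgeCount≡n+n)) (x+x≤y+y⇒x≤y (≤-reflexive (sym 2·edgeCount≡n+n)))
      n·Ω≡N : ∀ {i j} → G i j ≡ true → fromℕ n * Ω i j ≡ N
      n·Ω≡N {i} {j} i~j with effective i j i~j
      ... | x , kirchhoff , Ω≡ = ≤-antisym (n·Ω≤N i~j)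
        (subst (λ r → N ≤ fromℕ n * r) (sym Ω≡) (edge-resistance-≥ i~j x kirchhoff))
      term≡ : ∀ i j → G i j ≡ true → inv (Ω i j) - 1ℚ ≡ 1/N
      term≡ i j i~j = trans (cong (_- 1ℚ) (inv-unique {c = 1ℚ + 1/N} (0<Ω i~j) (begin
        (1ℚ + 1/N) * Ω i j          ≡⟨ trans (cong (_* Ω i j) (trans (sym n·1/N≡1+1/N) (*-comm (fromℕ n) 1/N))) (*-assoc 1/N (fromℕ n) (Ω i j)) ⟩
        1/N * (fromℕ n * Ω i j)     ≡⟨ cong (1/N *_) (n·Ω≡N i~j) ⟩
        1/N * N                     ≡⟨ trans (*-comm 1/N N) N·1/N≡1 ⟩
        1ℚ                          ∎)))
        (solve 1 (λ x → (con 1ℚ :+ x) :- con 1ℚ := x) refl 1/N)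
        where open ≡-Reasoning

    cyclicity≡1/N·n⇒cycle : cyclicity G Ω ≡ 1/N * fromℕ n → Isomorphic G (cycleGraph n)
    cyclicity≡1/N·n⇒cycle eq with any? (λ t → ¬? (t mod n Fin.≟ zero) ×-dec ¬? (t mod n Fin.≟ k mod n) ×-dec ¬? (t mod n Fin.≟ ⊖ (k mod n))) l
    ... | no none = isomorphic-to-cycle k∈l 2K≢0 only-±K
      where
      only-±K : ∀ {t} → t ∈ l → t mod n ≡ zero ⊎ t mod n ≡ k mod n ⊎ t mod n ≡ ⊖ (k mod n)
      only-±K {t} t∈l with t mod n Fin.≟ zero | t mod n Fin.≟ k mod n | t mod n Fin.≟ ⊖ (k mod n)
      ... | yes T≡0 | _ | _ = inj₁ T≡0
      ... | no _ | yes T≡K | _ = inj₂ (inj₁ T≡K)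
      ... | no _ | no _ | yes T≡-K = inj₂ (inj₂ T≡-K)
      ... | no T≢0 | no T≢K | no T≢-K = ⊥-elim (none (lose t∈l (T≢0 , T≢K , T≢-K)))
    ... | yes found with find found
    ...   | t , t∈l , T≢0 , T≢K , T≢-K = ⊥-elim (<-irrefl refl (<-≤-trans (0<fromℕ-suc (suc (suc m))) n≤0))
      where
      open ≤-Reasoning
      edgeCount≤n : edgeCount ≤ fromℕ n
      edgeCount≤n = *-cancelˡ-≤-pos 1/N {{ℚ.positive (0<1/suc (suc m))}} (≤-trans (cyclicity-≥ 1/N (λ i j → 1/N≤term)) (≤-reflexive eq))
      n≤0 : fromℕ n ≤ 0ℚ
      n≤0 = +-cancelʳ-≤ (fromℕ n + fromℕ n) (begin
        fromℕ n + (fromℕ n + fromℕ n)   ≡⟨ solve 1 (λ N → N :+ (N :+ N) := N :* (con 1ℚ :+ (con 1ℚ :+ con 1ℚ))) refl (fromℕ n) ⟩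
        fromℕ n * (1ℚ + (1ℚ + 1ℚ))      ≤⟨ degrees≥c⇒n·c≤2·edgeCount (degree-≥3 k∈l 2K≢0 t∈l T≢0 T≢K T≢-K) ⟩
        edgeCount + edgeCount           ≤⟨ +-mono-≤ edgeCount≤n edgeCount≤n ⟩
        fromℕ n + fromℕ n               ≡⟨ sym (+-identityˡ _) ⟩
        0ℚ + (fromℕ n + fromℕ n)        ∎)

    n/[n-1]≡1/N·n : ℤ.+ n ℚ./ suc (suc m) ≡ 1/N * fromℕ n
    n/[n-1]≡1/N·n = trans (/suc≡fromℕ*1/suc n (suc m)) (*-comm (fromℕ n) 1/N)

    n[n-1][n-2]/4≡[n-2]/2·pairCount : ℤ.+ (n ℕ.* suc (suc m) ℕ.* suc m) ℚ./ 4 ≡ [n-2]/2 * pairCount n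
    n[n-1][n-2]/4≡[n-2]/2·pairCount = begin
      ℤ.+ (n ℕ.* suc (suc m) ℕ.* suc m) ℚ./ 4          ≡⟨ /suc≡fromℕ*1/suc (n ℕ.* suc (suc m) ℕ.* suc m) 3 ⟩
      fromℕ (n ℕ.* suc (suc m) ℕ.* suc m) * (½ * ½)    ≡⟨ cong (_* (½ * ½)) (trans (fromℕ-* (n ℕ.* suc (suc m)) (suc m)) (cong (_* fromℕ (suc m)) (fromℕ-* n (suc (suc m))))) ⟩
      (fromℕ n * N * fromℕ (suc m)) * (½ * ½)          ≡⟨ solve 4 (λ a N s h → (a :* N :* s) :* (h :* h) := (s :* h) :* ((a :* N) :* h)) refl (fromℕ n) N (fromℕ (suc m)) ½ ⟩
      [n-2]/2 * ((fromℕ n * N) * ½)                    ≡⟨ cong (λ z → [n-2]/2 * (z * ½)) (sym (pairCount+pairCount (suc (suc m)))) ⟩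
      [n-2]/2 * ((pairCount n + pairCount n) * ½)      ≡⟨ cong ([n-2]/2 *_) (solve 2 (λ P h → (P :+ P) :* h := P :* (con (fromℕ 2) :* h)) refl (pairCount n) ½) ⟩
      [n-2]/2 * (pairCount n * (fromℕ 2 * ½))          ≡⟨ cong (λ z → [n-2]/2 * (pairCount n * z)) (fromℕ-suc*1/suc 1) ⟩
      [n-2]/2 * (pairCount n * 1ℚ)                     ≡⟨ cong ([n-2]/2 *_) (*-identityʳ (pairCount n)) ⟩
      [n-2]/2 * pairCount n                            ∎
      where open ≡-Reasoning

    lower-bound : ℤ.+ n ℚ./ suc (suc m) ≤ cyclicity G Ω
    lower-bound = subst (_≤ cyclicity G Ω) (sym n/[n-1]≡1/N·n) 1/N·n≤cyclicity

    upper-bound : cyclicity G Ω ≤ ℤ.+ (n ℕ.* suc (suc m) ℕ.* suc m) ℚ./ 4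
    upper-bound = subst (cyclicity G Ω ≤_) (sym n[n-1][n-2]/4≡[n-2]/2·pairCount) cyclicity≤[n-2]/2·pairCount

    lower-equality : (cyclicity G Ω ≡ ℤ.+ n ℚ./ suc (suc m)) ⇔ Isomorphic G (cycleGraph n)
    lower-equality = mk⇔ (λ eq → cyclicity≡1/N·n⇒cycle (trans eq n/[n-1]≡1/N·n))
                         (λ iso → trans (cycle⇒cyclicity≡1/N·n iso) (sym n/[n-1]≡1/N·n))

    upper-equality : (cyclicity G Ω ≡ ℤ.+ (n ℕ.* suc (suc m) ℕ.* suc m) ℚ./ 4) ⇔ Isomorphic G (completeGraph n)
    upper-equality = mk⇔ (λ eq → cyclicity≡[n-2]/2·pairCount⇒complete (trans eq n[n-1][n-2]/4≡[n-2]/2·pairCount))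
                         (λ iso → trans (complete⇒cyclicity≡[n-2]/2·pairCount iso) (sym n[n-1][n-2]/4≡[n-2]/2·pairCount))

open import Defs
open import Data.Nat using (ℕ; suc; _*_; _≤_)
open import Data.List using (List)
open import Data.List.Relation.Unary.All using (All)
open import Data.Integer using (+_)
open import Data.Rational using (ℚ) renaming (_≤_ to _≤ℚ_; _/_ to _/ℚ_)
open import Data.Fin using (Fin)
open import Data.Product using (_×_; _,_)
open import Relation.Binary.PropositionalEquality using (_≡_)
open import Function.Bundles using (_⇔_)

mainTheorem7 : (m : ℕ) → let n = suc (suc (suc m)) in
    (l : List ℕ) → All (λ k → 1 ≤ k) l →
    Connected (Circulant n l) →
    (Ω : Fin n → Fin n → ℚ) →
    ((i j : Fin n) → Edge (Circulant n l) i j → IsEffRes (Circulant n l) i j (Ω i j)) →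
    ((+ n) /ℚ (suc (suc m)) ≤ℚ cyclicity (Circulant n l) Ω)
    × (cyclicity (Circulant n l) Ω ≤ℚ (+ (n * suc (suc m) * suc m)) /ℚ 4)
    × ((cyclicity (Circulant n l) Ω ≡ (+ n) /ℚ (suc (suc m))) ⇔ Isomorphic (Circulant n l) (cycleGraph n))
    × ((cyclicity (Circulant n l) Ω ≡ (+ (n * suc (suc m) * suc m)) /ℚ 4) ⇔ Isomorphic (Circulant n l) (completeGraph n))
mainTheorem7 m l _ connected Ω effective = lower-bound , upper-bound , lower-equality , upper-equality
  where open CirculantNetworks.CirculantCyclicity m l connected Ω effective
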